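{- For every composition $\alpha$, \[\overline{H}_{\mathrm{Cat}(1\odot\alpha\odot1)}=\mathcal{H}(\alpha)\big|_{x_i=(y+z)^{i+1}\ (i\ge1)}=\sum_{\gamma\ge\alpha}\frac{y^{\ell(\gamma)-1}z^{\ell(\alpha)-\ell(\gamma)}}{(y+z)^{\ell(\alpha)-1}}\sum_{i=1}^{\ell(\gamma)}(y+z)^{\gamma_i+1}.\]
   Context: A composition is a finite sequence $\alpha=(a_1,\dots,a_k)$ of positive integers, with length $\ell(\alpha)=k$. For compositions of equal size, $\gamma\ge\alpha$ ($\gamma$ is a coarsening of $\alpha$) means every partial sum $g_1+\dots+g_j$ of $\gamma$ is a partial sum of $\alpha$. The near-concatenation of $(a_1,\dots,a_k)$ and $(b_1,\dots,b_m)$ is $(a_1,\dots,a_{k-1},a_k+b_1,b_2,\dots,b_m)$. Thus $1\odot\alpha\odot1$ is $\alpha$ with $1$ added to its first and to its last part (to the single part twice if $k=1$). Define \[\mathcal{H}(\alpha)=\sum_{\gamma\ge\alpha}\frac{y^{\ell(\gamma)-1}z^{\ell(\alpha)-\ell(\gamma)}}{(y+z)^{\ell(\alpha)-1}}\sum_{i=1}^{\ell(\gamma)}x_{\gamma_i}.\] For a composition $(c_1,\dots,c_k)$ with $c_1,c_k\ge2$, the caterpillar $\mathrm{Cat}(c_1,\dots,c_k)$ is the tree consisting of a path $v_1,\dots,v_k$ (the spine) in which each $v_i$ is additionally adjacent to $c_i-1$ leaves; it has $\sum c_i$ vertices. For a tree $T$, a subtree is a connected subgraph with nonempty vertex set.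 For a subtree $S$, $e(S)$ is the number of edges of $T$ with both endpoints in $S$ and $d(S)$ the number with exactly one endpoint in $S$. Then $\overline{H}_T=\sum_{S}y^{d(S)}z^{e(S)}$, summed over subtrees $S$ containing at least one non-leaf vertex of $T$. -}

module Defs where

open import Level using (Level)
open import Data.Bool using (Bool; true; false; _∧_; _∨_; not; if_then_else_)
open import Data.Nat using (ℕ; zero; suc; _+_; _∸_; _≡ᵇ_; _≤_; _≟_)
open import Data.Product using (_×_; _,_)
open import Data.List using (List; []; _∷_; _++_; map; length; upTo; concatMap; filter; foldr)
open import Data.Nat.ListAction using (sum)
open import Data.Bool.ListAction using (any; all)
open import Data.List.Relation.Unary.All using (All; all?)
open import Data.List.Membership.DecPropositional _≟_ using (_∈?_)
open import Data.List.Membership.Propositional using (_∈_)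
open import Relation.Binary.PropositionalEquality using (_≡_)
open import Relation.Nullary.Decidable using (_×-dec_)
open import Relation.Unary using (Decidable)
open import Algebra.Bundles using (CommutativeSemiring)

-- Compositions (lists of positive naturals)

ℓ : List ℕ → ℕ
ℓ = length

_⊙_ : List ℕ → List ℕ → List ℕ
[] ⊙ bs = bs
(a ∷ []) ⊙ [] = a ∷ []
(a ∷ []) ⊙ (b ∷ bs) = (a + b) ∷ bs
(a ∷ a' ∷ as) ⊙ bs = a ∷ ((a' ∷ as) ⊙ bs)

partialSumsFrom : ℕ → List ℕ → List ℕ
partialSumsFrom s [] = []
partialSumsFrom s (g ∷ gs) = (s + g) ∷ partialSumsFrom (s + g) gs

partialSums : List ℕ → List ℕ
partialSums = partialSumsFrom 0

-- γ ≥ α : γ is a coarsening of α (equal size, partial sums of γ are partial sums of α)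
_≽_ : List ℕ → List ℕ → Set
γ ≽ α = (sum γ ≡ sum α) × All (_∈ partialSums α) (partialSums γ)

≽-dec : (α : List ℕ) → Decidable (_≽ α)
≽-dec α γ = (sum γ ≟ sum α) ×-dec all? (_∈? partialSums α) (partialSums γ)

listsOfLen : ℕ → ℕ → List (List ℕ)
listsOfLen n zero = [] ∷ []
listsOfLen n (suc k) = concatMap (λ i → map (suc i ∷_) (listsOfLen n k)) (upTo n)

-- all lists of length ≤ n with entries in {1,…,n}; every composition of n is among them,
-- each exactly once
candidates : ℕ → List (List ℕ)
candidates n = concatMap (listsOfLen n) (upTo (suc n))

coarsenings : List ℕ → List (List ℕ)
coarsenings α = filter (≽-dec α) (candidates (sum α))

-- Graphs on vertex set {0,…,N-1} given by an edge list; vertex subsets as Bool lists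

record Graph : Set where
  constructor graph
  field
    N     : ℕ
    edges : List (ℕ × ℕ)
open Graph public

mem : List Bool → ℕ → Bool
mem [] v = false
mem (b ∷ bs) zero = b
mem (b ∷ bs) (suc v) = mem bs v

subsets : ℕ → List (List Bool)
subsets zero = [] ∷ []
subsets (suc n) = map (true ∷_) (subsets n) ++ map (false ∷_) (subsets n)

count : {A : Set} → (A → Bool) → List A → ℕ
count p [] = 0
count p (x ∷ xs) = if p x then suc (count p xs) else count p xs

degree : Graph → ℕ → ℕ
degree G v = count (λ { (a , b) → (a ≡ᵇ v) ∨ (b ≡ᵇ v) }) (edges G)

isLeaf : Graph → ℕ → Bool
isLeaf G v = degree G v ≡ᵇ 1

eS : Graph → List Bool → ℕ
eS G S = count (λ { (a , b) → mem S a ∧ mem S b }) (edges G)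

dS : Graph → List Bool → ℕ
dS G S = count (λ { (a , b) → (mem S a ∧ not (mem S b)) ∨ (mem S b ∧ not (mem S a)) }) (edges G)

reach : Graph → List Bool → ℕ → ℕ → ℕ → Bool
reach G S zero u v = u ≡ᵇ v
reach G S (suc m) u v =
  reach G S m u v ∨
  any (λ { (a , b) → mem S a ∧ mem S b ∧
             (((b ≡ᵇ v) ∧ reach G S m u a) ∨ ((a ≡ᵇ v) ∧ reach G S m u b)) })
      (edges G)

-- S (⊆ vertices) spans a subtree: nonempty and connected
-- (in a tree a connected subgraph is determined by its vertex set)
isSubtree : Graph → List Bool → Bool
isSubtree G S =
  any (mem S) (upTo (N G)) ∧
  all (λ u → all (λ v → not (mem S u ∧ mem S v) ∨ reach G S (N G) u v) (upTo (N G))) (upTo (N G))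

hasNonLeaf : Graph → List Bool → Bool
hasNonLeaf G S = any (λ v → mem S v ∧ not (isLeaf G v)) (upTo (N G))

-- Caterpillars Cat(c₁,…,c_k): spine vertices 0,…,k-1 (v_i = i-1);
-- leaves numbered k, k+1, …; spine vertex i gets c_{i+1} - 1 leaves.

catEdges : ℕ → ℕ → List ℕ → List (ℕ × ℕ)
catEdges i nxt [] = []
catEdges i nxt (c ∷ cs) =
  map (λ j → (i , nxt + j)) (upTo (c ∸ 1)) ++ spine cs ++ catEdges (suc i) (nxt + (c ∸ 1)) cs
  where
  spine : List ℕ → List (ℕ × ℕ)
  spine [] = []
  spine (_ ∷ _) = (i , suc i) ∷ []

Cat : List ℕ → Graph
Cat c = graph (sum c) (catEdges 0 (length c) c)

module _ {a ℓ' : Level} (R : CommutativeSemiring a ℓ') where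
  open CommutativeSemiring R using (Carrier; 0#; 1#) renaming (_+_ to _⊕_; _*_ to _⊛_)

  pow : Carrier → ℕ → Carrier
  pow x zero = 1#
  pow x (suc n) = x ⊛ pow x n

  Σ : {A : Set} → List A → (A → Carrier) → Carrier
  Σ xs f = foldr (λ x acc → f x ⊕ acc) 0# xs

  Hbar : Graph → Carrier → Carrier → Carrier
  Hbar G y z = Σ (subsets (N G)) (λ S →
    if isSubtree G S ∧ hasNonLeaf G S then pow y (dS G S) ⊛ pow z (eS G S) else 0#)

  -- numerator of 𝓗(α)|_{x_i = (y+z)^{i+1}}, i.e. (y+z)^{ℓ(α)-1} · 𝓗(α)|_{…}:
  -- Σ_{γ ≥ α} y^{ℓ(γ)-1} z^{ℓ(α)-ℓ(γ)} Σ_i (y+z)^{γ_i+1}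
  Hnum : List ℕ → Carrier → Carrier → Carrier
  Hnum α y z = Σ (coarsenings α) (λ γ →
    pow y (ℓ γ ∸ 1) ⊛ pow z (ℓ α ∸ ℓ γ) ⊛ Σ γ (λ g → pow (y ⊕ z) (suc g)))

-- Let D = (d₁, …, d_k) be the numbers of leaves on the spine of Cat(1 ⊙ α ⊙ 1), so d₁ = a₁,
-- d_i = a_i - 1 inside and d_k = a_k (d₁ = a₁ + 1 if k = 1); then no spine vertex is a leaf.
-- A subtree containing a non-leaf vertex is a nonempty interval of the spine together with any
-- set of leaves hanging from it. Summing over the leaves first, spine vertex i of the interval
-- contributes (y+z)^{d_i}, and the interval contributes y for each spine edge leaving it and z
-- for each spine edge inside it. Splitting this interval sum by whether the interval starts at
-- the first spine vertex, and the sum over coarsenings γ ≥ α by whether γ keeps the first cut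
-- of α, shows that (y+z)^{ℓ(α)-1} H̄ and the numerator of 𝓗(α) satisfy the same recursion.

{-# OPTIONS --safe #-}
module Submission where

open import Defs
open import Level using (Level)
open import Function using (_∘_; _⇔_; mk⇔; Equivalence)
open Equivalence using (to; from)
open import Algebra.Bundles using (CommutativeSemiring)
open import Data.Bool using (Bool; true; false; _∧_; _∨_; not; if_then_else_; T)
open import Data.Bool.Properties using (T-∧; T-∨; T-not-≡)
open import Data.Nat using (ℕ; zero; suc; _+_; _∸_; _≤_; _<_; s≤s; z≤n; _≡ᵇ_; _≤′_; ≤′-refl; ≤′-step)
import Data.Nat.Properties as ℕ
open import Algebra.Properties.CommutativeSemigroup ℕ.+-commutativeSemigroup using (x∙yz≈y∙xz)
open import Data.List using (List; []; _∷_; _++_; map; length; concat; concatMap; upTo; applyUpTo; replicate)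
open import Data.Nat.ListAction using (sum)
open import Data.List.Properties using (length-map; length-++; ∷-injectiveˡ; ∷-injectiveʳ)
open import Data.List.Relation.Unary.All as All using (All; []; _∷_; universal)
open import Data.Bool.ListAction using (all)
open import Data.List.Relation.Unary.All.Properties using (all⁺; all⁻; ++⁺; map⁺; concat⁺)
open import Data.List.Relation.Unary.Any using (here; there)
open import Data.List.Relation.Unary.Any.Properties using (any⁺; any⁻)
open import Data.List.Membership.Propositional using (_∈_; find; lose)
open import Data.List.Membership.Propositional.Properties
  using (∈-upTo⁺; ∈-upTo⁻; ∈-applyUpTo⁻; ∈-map⁺; ∈-map⁻; ∈-++⁺ˡ; ∈-++⁺ʳ; ∈-++⁻; ∈-concatMap⁺; ∈-concatMap⁻;
         ∈-filter⁺; ∈-filter⁻)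
open import Data.List.Membership.Propositional.Properties.WithK using (unique∧set⇒bag)
open import Data.List.Relation.Binary.BagAndSetEquality using (∼bag⇒↭)
open import Data.List.Relation.Binary.Disjoint.Propositional using (Disjoint)
open import Data.List.Relation.Unary.Unique.Propositional using (Unique; []; _∷_)
import Data.List.Relation.Unary.Unique.Propositional.Properties as Unique
import Data.List.Relation.Unary.AllPairs.Properties as AllPairs
open import Data.List.Relation.Binary.Permutation.Propositional as ↭ using (_↭_)
open import Data.Product using (∃; _×_; _,_; proj₁; proj₂)
open import Data.Sum using (_⊎_; inj₁; inj₂)
open import Data.Empty using (⊥; ⊥-elim)
open import Relation.Nullary using (¬_)
open import Relation.Binary.PropositionalEquality as ≡ using (_≡_; _≢_; refl)

-- Bit lists as finite sets

mem-++ˡ : (s t : List Bool) {i : ℕ} → i < length s → mem (s ++ t) i ≡ mem s i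
mem-++ˡ (b ∷ s) t {zero}  _        = refl
mem-++ˡ (b ∷ s) t {suc i} (s≤s lt) = mem-++ˡ s t lt

mem-++ʳ : (s t : List Bool) (i : ℕ) → mem (s ++ t) (length s + i) ≡ mem t i
mem-++ʳ []      t i = refl
mem-++ʳ (b ∷ s) t i = mem-++ʳ s t i

mem⇒< : (s : List Bool) {i : ℕ} → T (mem s i) → i < length s
mem⇒< (b ∷ s) {zero}  _ = s≤s z≤n
mem⇒< (b ∷ s) {suc i} m = s≤s (mem⇒< s m)

length-concat : (ls : List (List Bool)) → length (concat ls) ≡ sum (map length ls)
length-concat []       = refl
length-concat (l ∷ ls) = ≡.trans (length-++ l) (≡.cong (length l +_) (length-concat ls))

allFalse : List Bool → Bool
allFalse []          = true
allFalse (true ∷ s)  = false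
allFalse (false ∷ s) = allFalse s

isInitialSegment : List Bool → Bool
isInitialSegment []          = true
isInitialSegment (true ∷ s)  = isInitialSegment s
isInitialSegment (false ∷ s) = allFalse s

isInterval : List Bool → Bool
isInterval []          = false
isInterval (true ∷ s)  = isInitialSegment s
isInterval (false ∷ s) = isInterval s

DownClosed : List Bool → Set
DownClosed s = ∀ {i j} → i ≤ j → T (mem s j) → T (mem s i)

Convex : List Bool → Set
Convex s = ∀ {i j k} → i ≤ j → j ≤ k → T (mem s i) → T (mem s k) → T (mem s j)

allFalse⇒ : (s : List Bool) → T (allFalse s) → ∀ i → ¬ T (mem s i)
allFalse⇒ (false ∷ s) h zero    ()
allFalse⇒ (false ∷ s) h (suc i) = allFalse⇒ s h i

allFalse⇐ : (s : List Bool) → (∀ i → ¬ T (mem s i)) → T (allFalse s)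
allFalse⇐ []          h = _
allFalse⇐ (true ∷ s)  h = h 0 _
allFalse⇐ (false ∷ s) h = allFalse⇐ s (h ∘ suc)

isInitialSegment⇒ : (s : List Bool) → T (isInitialSegment s) → DownClosed s
isInitialSegment⇒ (true ∷ s)  h {zero}            _        _ = _
isInitialSegment⇒ (true ∷ s)  h {suc i} {suc j}   (s≤s le) m = isInitialSegment⇒ s h le m
isInitialSegment⇒ (false ∷ s) h {j = suc j}       _        m = ⊥-elim (allFalse⇒ s h j m)

isInitialSegment⇐ : (s : List Bool) → DownClosed s → T (isInitialSegment s)
isInitialSegment⇐ []          dc = _
isInitialSegment⇐ (true ∷ s)  dc = isInitialSegment⇐ s (λ le → dc (s≤s le))
isInitialSegment⇐ (false ∷ s) dc = allFalse⇐ s (λ j → dc {0} {suc j} z≤n)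

isInterval⇒ : (s : List Bool) → T (isInterval s) → (∃ λ i → T (mem s i)) × Convex s
isInterval⇒ (true ∷ s)  h = (0 , _) , convex
  where
  convex : Convex (true ∷ s)
  convex {j = zero}               _ _          _ _  = _
  convex {j = suc j} {k = suc k}  _ (s≤s j≤k)  _ mk = isInitialSegment⇒ s h j≤k mk
isInterval⇒ (false ∷ s) h with (i , mᵢ) , convex ← isInterval⇒ s h =
  (suc i , mᵢ) , λ { {suc _} {suc _} {suc _} (s≤s i≤j) (s≤s j≤k) → convex i≤j j≤k }

isInterval⇐ : (s : List Bool) → (∃ λ i → T (mem s i)) → Convex s → T (isInterval s)
isInterval⇐ (true ∷ s)  _           cv = isInitialSegment⇐ s (λ le → cv {0} z≤n (s≤s le) _)
isInterval⇐ (false ∷ s) (suc i , m) cv = isInterval⇐ s (i , m) (λ le₁ le₂ → cv (s≤s le₁) (s≤s le₂))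

T-conflict : ∀ {x y r} → T x → T y → T (not (x ∧ y) ∨ r) → T r
T-conflict {true} {true} _ _ h = h

T-injective : ∀ {x y} → T x ⇔ T y → x ≡ y
T-injective {false} {false} _ = refl
T-injective {false} {true}  e = ⊥-elim (from e _)
T-injective {true}  {false} e = ⊥-elim (to e _)
T-injective {true}  {true}  _ = refl

subsets-length : ∀ n → All (λ s → length s ≡ n) (subsets n)
subsets-length zero    = refl ∷ []
subsets-length (suc n) = ++⁺ (map⁺ (All.map (≡.cong suc) (subsets-length n)))
                             (map⁺ (All.map (≡.cong suc) (subsets-length n)))

blockSubsets : List ℕ → List (List (List Bool))
blockSubsets []      = [] ∷ []
blockSubsets (d ∷ D) = concatMap (λ l → map (l ∷_) (blockSubsets D)) (subsets d)

blockSubsets-lengths : ∀ D → All (λ ls → map length ls ≡ D) (blockSubsets D)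
blockSubsets-lengths []      = refl ∷ []
blockSubsets-lengths (d ∷ D) =
  concat⁺ (map⁺ (All.map (λ |l| → map⁺ (All.map (≡.cong₂ _∷_ |l|) (blockSubsets-lengths D)))
                                                     (subsets-length d)))
module _ {A : Set} (p : A → Bool) where

  count-∷-true : ∀ {x} xs → T (p x) → count p (x ∷ xs) ≡ suc (count p xs)
  count-∷-true {x} xs px with p x
  ... | true = refl

  count-∷-false : ∀ {x} xs → ¬ T (p x) → count p (x ∷ xs) ≡ count p xs
  count-∷-false {x} xs px with p x
  ... | true  = ⊥-elim (px _)
  ... | false = refl

  count-++ : (xs ys : List A) → count p (xs ++ ys) ≡ count p xs + count p ys
  count-++ []       ys = refl
  count-++ (x ∷ xs) ys with p x
  ... | true  = ≡.cong suc (count-++ xs ys)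
  ... | false = count-++ xs ys

  count-none : (xs : List A) → (∀ {x} → x ∈ xs → ¬ T (p x)) → count p xs ≡ 0
  count-none []       h = refl
  count-none (x ∷ xs) h = ≡.trans (count-∷-false xs (h (here refl))) (count-none xs (h ∘ there))

  ∈⇒1≤count : ∀ {x xs} → x ∈ xs → T (p x) → 1 ≤ count p xs
  ∈⇒1≤count {xs = _ ∷ xs} (here refl) px = ≡.subst (1 ≤_) (≡.sym (count-∷-true xs px)) (s≤s z≤n)
  ∈⇒1≤count {xs = y ∷ xs} (there m)   px with p y
  ... | true  = s≤s z≤n
  ... | false = ∈⇒1≤count m px

  ∈⇒2≤count : ∀ {x y xs} → x ∈ xs → y ∈ xs → x ≢ y → T (p x) → T (p y) → 2 ≤ count p xs
  ∈⇒2≤count (here refl) (here refl) x≢y _  _  = ⊥-elim (x≢y refl)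
  ∈⇒2≤count {xs = _ ∷ xs} (here refl) (there my) _ px py =
    ℕ.≤-trans (s≤s (∈⇒1≤count my py)) (ℕ.≤-reflexive (≡.sym (count-∷-true xs px)))
  ∈⇒2≤count {xs = _ ∷ xs} (there mx) (here refl) _ px py =
    ℕ.≤-trans (s≤s (∈⇒1≤count mx px)) (ℕ.≤-reflexive (≡.sym (count-∷-true xs py)))
  ∈⇒2≤count {xs = z ∷ xs} (there mx) (there my) x≢y px py with p z
  ... | true  = ℕ.m≤n⇒m≤1+n (∈⇒2≤count mx my x≢y px py)
  ... | false = ∈⇒2≤count mx my x≢y px py

  count-applyUpTo-single : (h : ℕ → A) {d j : ℕ} → j < d → T (p (h j)) →
                           (∀ {i} → i ≢ j → ¬ T (p (h i))) → count p (applyUpTo h d) ≡ 1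
  count-applyUpTo-single h {suc d} {zero} _ pj others =
    ≡.trans (count-∷-true (applyUpTo (h ∘ suc) d) pj) (≡.cong suc (count-none _ none))
    where
    none : ∀ {x} → x ∈ applyUpTo (h ∘ suc) d → ¬ T (p x)
    none m with _ , _ , refl ← ∈-applyUpTo⁻ (h ∘ suc) m = others (λ ())
  count-applyUpTo-single h {suc d} {suc j} (s≤s j<d) pj others =
    ≡.trans (count-∷-false (applyUpTo (h ∘ suc) d) (others (λ ())))
      (count-applyUpTo-single (h ∘ suc) j<d pj (λ i≢j → others (i≢j ∘ ℕ.suc-injective)))

count-replicate : {A : Set} (p : A → Bool) {x : A} → ¬ T (p x) → ∀ n → count p (replicate n x) ≡ 0
count-replicate p px zero    = refl
count-replicate p px (suc n) = ≡.trans (count-∷-false p (replicate n _) px) (count-replicate p px n)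

count-map : {A B : Set} (p : B → Bool) (f : A → B) (xs : List A) → count p (map f xs) ≡ count (p ∘ f) xs
count-map p f []       = refl
count-map p f (x ∷ xs) with p (f x)
... | true  = ≡.cong suc (count-map p f xs)
... | false = count-map p f xs

count-cong : {A : Set} {p q : A → Bool} (xs : List A) → (∀ x → p x ≡ q x) → count p xs ≡ count q xs
count-cong         []       e = refl
count-cong {q = q} (x ∷ xs) e rewrite e x with q x
... | true  = ≡.cong suc (count-cong xs e)
... | false = count-cong xs e

-- Finite sums in a commutative semiring

module FiniteSums {a ℓ : Level} (R : CommutativeSemiring a ℓ) where
  open CommutativeSemiring R renaming (_+_ to _⊕_; _*_ to _⊛_; refl to ≈-refl)
  open import Algebra.Solver.Ring.NaturalCoefficients.Default R
  open import Relation.Binary.Reasoning.Setoid setoid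

  Σ-congᴬ : {A : Set} {xs : List A} {f g : A → Carrier} →
            All (λ x → f x ≈ g x) xs → Σ R xs f ≈ Σ R xs g
  Σ-congᴬ []       = ≈-refl
  Σ-congᴬ (e ∷ es) = +-cong e (Σ-congᴬ es)

  Σ-cong : {A : Set} (xs : List A) {f g : A → Carrier} →
           (∀ x → f x ≈ g x) → Σ R xs f ≈ Σ R xs g
  Σ-cong xs e = Σ-congᴬ (universal e xs)

  Σ-zero : {A : Set} (xs : List A) → Σ R xs (λ _ → 0#) ≈ 0#
  Σ-zero []       = ≈-refl
  Σ-zero (x ∷ xs) = trans (+-identityˡ _) (Σ-zero xs)

  Σ-++ : {A : Set} (xs ys : List A) (f : A → Carrier) →
         Σ R (xs ++ ys) f ≈ Σ R xs f ⊕ Σ R ys f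
  Σ-++ []       ys f = sym (+-identityˡ _)
  Σ-++ (x ∷ xs) ys f = trans (+-congˡ (Σ-++ xs ys f)) (sym (+-assoc _ _ _))

  Σ-map : {A B : Set} (g : A → B) (xs : List A) (f : B → Carrier) →
          Σ R (map g xs) f ≡ Σ R xs (f ∘ g)
  Σ-map g []       f = refl
  Σ-map g (x ∷ xs) f = ≡.cong (f (g x) ⊕_) (Σ-map g xs f)

  Σ-concatMap : {A B : Set} (g : A → List B) (xs : List A) (f : B → Carrier) →
                Σ R (concatMap g xs) f ≈ Σ R xs (λ x → Σ R (g x) f)
  Σ-concatMap g []       f = ≈-refl
  Σ-concatMap g (x ∷ xs) f = trans (Σ-++ (g x) _ f) (+-congˡ (Σ-concatMap g xs f))

  Σ-+ : {A : Set} (xs : List A) (f g : A → Carrier) →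
        Σ R xs (λ x → f x ⊕ g x) ≈ Σ R xs f ⊕ Σ R xs g
  Σ-+ []       f g = sym (+-identityˡ _)
  Σ-+ (x ∷ xs) f g = trans (+-congˡ (Σ-+ xs f g))
    (solve 4 (λ a b c d → (a :+ b) :+ (c :+ d) := (a :+ c) :+ (b :+ d)) ≈-refl _ _ _ _)

  Σ-*ˡ : {A : Set} (xs : List A) (c : Carrier) (f : A → Carrier) →
         Σ R xs (λ x → c ⊛ f x) ≈ c ⊛ Σ R xs f
  Σ-*ˡ []       c f = sym (zeroʳ c)
  Σ-*ˡ (x ∷ xs) c f = trans (+-congˡ (Σ-*ˡ xs c f)) (sym (distribˡ c _ _))

  Σ-*ʳ : {A : Set} (xs : List A) (c : Carrier) (f : A → Carrier) →
         Σ R xs (λ x → f x ⊛ c) ≈ Σ R xs f ⊛ c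
  Σ-*ʳ []       c f = sym (zeroˡ c)
  Σ-*ʳ (x ∷ xs) c f = trans (+-congˡ (Σ-*ʳ xs c f)) (sym (distribʳ c _ _))

  Σ-↭ : {A : Set} {xs ys : List A} (f : A → Carrier) → xs ↭ ys → Σ R xs f ≈ Σ R ys f
  Σ-↭ f ↭.refl          = ≈-refl
  Σ-↭ f (↭.prep x p)    = +-congˡ (Σ-↭ f p)
  Σ-↭ f (↭.swap x y p)  = trans (+-congˡ (+-congˡ (Σ-↭ f p)))
    (solve 3 (λ a b c → a :+ (b :+ c) := b :+ (a :+ c)) ≈-refl _ _ _)
  Σ-↭ f (↭.trans p q)   = trans (Σ-↭ f p) (Σ-↭ f q)

  pow-+ : (x : Carrier) (m n : ℕ) → pow R x (m + n) ≈ pow R x m ⊛ pow R x n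
  pow-+ x zero    n = sym (*-identityˡ _)
  pow-+ x (suc m) n = trans (*-congˡ (pow-+ x m n)) (sym (*-assoc _ _ _))

  Σ-subsets-suc : (n : ℕ) (f : List Bool → Carrier) →
    Σ R (subsets (suc n)) f ≈ Σ R (subsets n) (f ∘ (true ∷_)) ⊕ Σ R (subsets n) (f ∘ (false ∷_))
  Σ-subsets-suc n f = trans (Σ-++ (map (true ∷_) (subsets n)) _ f)
    (reflexive (≡.cong₂ _⊕_ (Σ-map (true ∷_) (subsets n) f) (Σ-map (false ∷_) (subsets n) f)))

  Σ-subsets-+ : (m n : ℕ) (f : List Bool → Carrier) →
    Σ R (subsets (m + n)) f ≈ Σ R (subsets m) (λ s → Σ R (subsets n) (λ t → f (s ++ t)))
  Σ-subsets-+ zero    n f = sym (+-identityʳ _)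
  Σ-subsets-+ (suc m) n f = begin
    Σ R (subsets (suc (m + n))) f
      ≈⟨ Σ-subsets-suc (m + n) f ⟩
    Σ R (subsets (m + n)) (f ∘ (true ∷_)) ⊕ Σ R (subsets (m + n)) (f ∘ (false ∷_))
      ≈⟨ +-cong (Σ-subsets-+ m n _) (Σ-subsets-+ m n _) ⟩
    Σ R (subsets m) (λ s → Σ R (subsets n) (λ t → f (true ∷ s ++ t))) ⊕
    Σ R (subsets m) (λ s → Σ R (subsets n) (λ t → f (false ∷ s ++ t)))
      ≈⟨ sym (Σ-subsets-suc m _) ⟩
    Σ R (subsets (suc m)) (λ s → Σ R (subsets n) (λ t → f (s ++ t))) ∎

  when : Bool → Carrier → Carrier
  when b x = if b then x else 0#

  when-*ˡ : ∀ b c x → when b (c ⊛ x) ≈ c ⊛ when b x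
  when-*ˡ true  c x = ≈-refl
  when-*ˡ false c x = sym (zeroʳ c)

  when-∧ : ∀ b b′ {x c c′ x′} → x ≈ c ⊛ (c′ ⊛ x′) →
           when (b ∧ b′) x ≈ when b c ⊛ (c′ ⊛ when b′ x′)
  when-∧ true  true  e = e
  when-∧ true  false e = sym (trans (*-congˡ (zeroʳ _)) (zeroʳ _))
  when-∧ false b′    e = sym (zeroˡ _)

  Σ-subsets-allFalse : ∀ n (f : List Bool → Carrier) →
                       Σ R (subsets n) (λ s → when (allFalse s) (f s)) ≈ f (replicate n false)
  Σ-subsets-allFalse zero    f = +-identityʳ _
  Σ-subsets-allFalse (suc n) f = begin
    Σ R (subsets (suc n)) (λ s → when (allFalse s) (f s))
      ≈⟨ Σ-subsets-suc n _ ⟩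
    Σ R (subsets n) (λ _ → 0#) ⊕ Σ R (subsets n) (λ s → when (allFalse s) (f (false ∷ s)))
      ≈⟨ +-cong (Σ-zero (subsets n)) (Σ-subsets-allFalse n (f ∘ (false ∷_))) ⟩
    0# ⊕ f (replicate (suc n) false)
      ≈⟨ +-identityˡ _ ⟩
    f (replicate (suc n) false) ∎

  Σ-blockSubsets : ∀ D (f : List Bool → Carrier) →
                   Σ R (subsets (sum D)) f ≈ Σ R (blockSubsets D) (f ∘ concat)
  Σ-blockSubsets []      f = ≈-refl
  Σ-blockSubsets (d ∷ D) f = begin
    Σ R (subsets (d + sum D)) f
      ≈⟨ Σ-subsets-+ d (sum D) f ⟩
    Σ R (subsets d) (λ l → Σ R (subsets (sum D)) (λ L → f (l ++ L)))
      ≈⟨ Σ-cong (subsets d) (λ l → Σ-blockSubsets D (λ L → f (l ++ L))) ⟩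
    Σ R (subsets d) (λ l → Σ R (blockSubsets D) (λ ls → f (l ++ concat ls)))
      ≈⟨ Σ-cong (subsets d) (λ l → reflexive (≡.sym (Σ-map (l ∷_) (blockSubsets D) (f ∘ concat)))) ⟩
    Σ R (subsets d) (λ l → Σ R (map (l ∷_) (blockSubsets D)) (f ∘ concat))
      ≈⟨ sym (Σ-concatMap (λ l → map (l ∷_) (blockSubsets D)) (subsets d) (f ∘ concat)) ⟩
    Σ R (blockSubsets (d ∷ D)) (f ∘ concat) ∎

  when-cong : ∀ b {x x′} → x ≈ x′ → when b x ≈ when b x′
  when-cong true  e = e
  when-cong false e = ≈-refl

  Σ-when-∧ : ∀ b {A : Set} (xs : List A) (p : A → Bool) (f : A → Carrier) →
             Σ R xs (λ x → when (b ∧ p x) (f x)) ≈ when b (Σ R xs (λ x → when (p x) (f x)))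
  Σ-when-∧ true  xs p f = ≈-refl
  Σ-when-∧ false xs p f = Σ-zero xs

-- Reachability inside a vertex set

module _ (G : Graph) (S : List Bool) where

  Adjacent : ℕ → ℕ → Set
  Adjacent a b = (a , b) ∈ edges G ⊎ (b , a) ∈ edges G

  reach-refl : ∀ m u → T (reach G S m u u)
  reach-refl zero    u = ℕ.≡⇒≡ᵇ u u refl
  reach-refl (suc m) u = from T-∨ (inj₁ (reach-refl m u))

  reach-mono : ∀ {m m′ u v} → m ≤ m′ → T (reach G S m u v) → T (reach G S m′ u v)
  reach-mono = go ∘ ℕ.≤⇒≤′
    where
    go : ∀ {m m′ u v} → m ≤′ m′ → T (reach G S m u v) → T (reach G S m′ u v)
    go ≤′-refl       r = r
    go (≤′-step le)  r = from T-∨ (inj₁ (go le r))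

  reach-step : ∀ m {u a b} → T (reach G S m u a) → T (mem S a) → T (mem S b) → Adjacent a b →
               T (reach G S (suc m) u b)
  reach-step m {u} {a} {b} r ma mb (inj₁ ab) = from T-∨ (inj₂ (any⁺ _ (lose ab
    (from T-∧ (ma , from T-∧ (mb , from T-∨ (inj₁ (from T-∧ (ℕ.≡⇒≡ᵇ b b refl , r)))))))))
  reach-step m {u} {a} {b} r ma mb (inj₂ ba) = from T-∨ (inj₂ (any⁺ _ (lose ba
    (from T-∧ (mb , from T-∧ (ma , from T-∨ (inj₂ (from T-∧ (ℕ.≡⇒≡ᵇ b b refl , r)))))))))

  EdgeClosed : (ℕ → Set) → Set
  EdgeClosed Q = ∀ {a b} → (a , b) ∈ edges G → T (mem S a) → T (mem S b) → (Q a → Q b) × (Q b → Q a)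

  reach-closed : {Q : ℕ → Set} → EdgeClosed Q → ∀ m {u v} → T (reach G S m u v) → Q u → Q v
  reach-closed {Q} cl zero    {u} {v} r q = ≡.subst Q (ℕ.≡ᵇ⇒≡ u v r) q
  reach-closed {Q} cl (suc m) {u} {v} r q with to T-∨ r
  ... | inj₁ r′ = reach-closed cl m r′ q
  ... | inj₂ r′ with (a , b) , ab , hit ← find (any⁻ _ (edges G) r′)
                   with ma , hit′ ← to T-∧ hit
                   with mb , hit″ ← to T-∧ hit′
                   with to T-∨ hit″
  ... | inj₁ h = let b≡v , ra = to T-∧ h in
    ≡.subst Q (ℕ.≡ᵇ⇒≡ b v b≡v) (proj₁ (cl ab ma mb) (reach-closed cl m ra q))
  ... | inj₂ h = let a≡v , rb = to T-∧ h in
    ≡.subst Q (ℕ.≡ᵇ⇒≡ a v a≡v) (proj₂ (cl ab ma mb) (reach-closed cl m rb q))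

  Connected : Set
  Connected = ∀ {u v} → T (mem S u) → T (mem S v) → T (reach G S (N G) u v)

  module _ (|S| : length S ≡ N G) where

    private
      vertex : ∀ {v} → T (mem S v) → v ∈ upTo (N G)
      vertex m = ∈-upTo⁺ (≡.subst (_ <_) |S| (mem⇒< S m))

      linked : ℕ → ℕ → Bool
      linked u w = not (mem S u ∧ mem S w) ∨ reach G S (N G) u w

      nonLeafIn : ℕ → Bool
      nonLeafIn v = mem S v ∧ not (isLeaf G v)

    isSubtree⇔ : T (isSubtree G S) ⇔ ((∃ λ v → T (mem S v)) × Connected)
    isSubtree⇔ = mk⇔ ⇒ ⇐
      where
      ⇒ : T (isSubtree G S) → (∃ λ v → T (mem S v)) × Connected
      ⇒ h with nonempty , connected ← to T-∧ h with v , _ , mv ← find (any⁻ (mem S) (upTo (N G)) nonempty) =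
        (v , mv) , λ mu mv → T-conflict mu mv
          (All.lookup (all⁺ (linked _) (upTo (N G))
            (All.lookup (all⁺ (λ u → all (linked u) (upTo (N G))) (upTo (N G)) connected) (vertex mu)))
            (vertex mv))
      ⇐ : (∃ λ v → T (mem S v)) × Connected → T (isSubtree G S)
      ⇐ ((v , mv) , connected) = from T-∧
        ( any⁺ (mem S) (lose (vertex mv) mv)
        , all⁻ (λ u → all (linked u) (upTo (N G))) {xs = upTo (N G)}
            (All.tabulate λ {u} _ → all⁻ (linked u) {xs = upTo (N G)} (All.tabulate λ {w} _ → pair u w)))
        where
        pair : ∀ u w → T (linked u w)
        pair u w with mem S u in eu | mem S w in ew
        ... | true  | true  = from T-∨ (inj₂ (connected (≡.subst T (≡.sym eu) _) (≡.subst T (≡.sym ew) _)))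
        ... | true  | false = _
        ... | false | _     = _

    hasNonLeaf⇔ : T (hasNonLeaf G S) ⇔ (∃ λ v → T (mem S v) × isLeaf G v ≡ false)
    hasNonLeaf⇔ = mk⇔ ⇒ ⇐
      where
      ⇒ : T (hasNonLeaf G S) → ∃ λ v → T (mem S v) × isLeaf G v ≡ false
      ⇒ h with v , _ , hit ← find (any⁻ nonLeafIn (upTo (N G)) h) with mv , nl ← to T-∧ hit = v , mv , to T-not-≡ nl
      ⇐ : (∃ λ v → T (mem S v) × isLeaf G v ≡ false) → T (hasNonLeaf G S)
      ⇐ (v , mv , nl) = any⁺ nonLeafIn (lose (vertex mv) (from T-∧ (mv , from T-not-≡ nl)))

-- The edges of a caterpillar

data Offset (d : ℕ) : ℕ → Set where
  below : ∀ {t} → t < d → Offset d t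
  above : ∀ t → Offset d (d + t)

offset : ∀ d t → Offset d t
offset zero    t       = above t
offset (suc d) zero    = below (s≤s z≤n)
offset (suc d) (suc t) with offset d t
... | below t<d = below (s≤s t<d)
... | above t′  = above t′

-- owner D t is the block containing t when ℕ is cut into consecutive blocks of sizes D;
-- in Cat (map suc D) the leaf length D + t hangs from the spine vertex owner D t.
owner : List ℕ → ℕ → ℕ
owner []          t       = 0
owner (zero ∷ D)  t       = suc (owner D t)
owner (suc d ∷ D) zero    = 0
owner (suc d ∷ D) (suc t) = owner (d ∷ D) t

owner-< : ∀ d D {t} → t < d → owner (d ∷ D) t ≡ 0
owner-< (suc d) D {zero}  _        = refl
owner-< (suc d) D {suc t} (s≤s lt) = owner-< d D lt

owner-+ : ∀ d D t → owner (d ∷ D) (d + t) ≡ suc (owner D t)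
owner-+ zero    D t = refl
owner-+ (suc d) D t = owner-+ d D t

owner<length : ∀ D {t} → t < sum D → owner D t < length D
owner<length (d ∷ D) {t} lt with offset d t
... | below t<d = ≡.subst (_< length (d ∷ D)) (≡.sym (owner-< d D t<d)) (s≤s z≤n)
... | above t′  = ≡.subst (_< length (d ∷ D)) (≡.sym (owner-+ d D t′))
                    (s≤s (owner<length D (ℕ.+-cancelˡ-< d t′ (sum D) lt)))

leafEdges : ℕ → ℕ → ℕ → List (ℕ × ℕ)
leafEdges i nxt d = map (λ j → (i , nxt + j)) (upTo d)

spineEdge : ℕ → List ℕ → List (ℕ × ℕ)
spineEdge i []      = []
spineEdge i (_ ∷ _) = (i , suc i) ∷ []

catEdges-∷ : ∀ i nxt d D → catEdges i nxt (map suc (d ∷ D)) ≡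
             leafEdges i nxt d ++ spineEdge i D ++ catEdges (suc i) (nxt + d) (map suc D)
catEdges-∷ i nxt d []      = refl
catEdges-∷ i nxt d (_ ∷ _) = refl

data CatEdge (i nxt : ℕ) (D : List ℕ) : ℕ → ℕ → Set where
  spine : ∀ {p} → i ≤ p → suc p < i + length D → CatEdge i nxt D p (suc p)
  leaf  : ∀ {t a b} → t < sum D → a ≡ i + owner D t → b ≡ nxt + t → CatEdge i nxt D a b

catEdge-shift : ∀ {i nxt d D a b} → CatEdge (suc i) (nxt + d) D a b → CatEdge i nxt (d ∷ D) a b
catEdge-shift {i} {D = D} (spine {p} i<p lt) = spine (ℕ.<⇒≤ i<p) (≡.subst (suc p <_) (≡.sym (ℕ.+-suc i (length D))) lt)
catEdge-shift {i} {nxt} {d} {D} (leaf {t} lt refl refl) =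
  leaf (ℕ.+-monoʳ-< d lt)
       (≡.sym (≡.trans (≡.cong (i +_) (owner-+ d D t)) (ℕ.+-suc i (owner D t))))
       (ℕ.+-assoc nxt d t)

catEdge⁻ : ∀ i nxt D {a b} → (a , b) ∈ catEdges i nxt (map suc D) → CatEdge i nxt D a b
catEdge⁻ i nxt (d ∷ D) e rewrite catEdges-∷ i nxt d D with ∈-++⁻ (leafEdges i nxt d) e
... | inj₁ e′ with j , j<d , refl ← ∈-map⁻ _ e′ =
  leaf (ℕ.≤-trans (∈-upTo⁻ j<d) (ℕ.m≤m+n d (sum D)))
       (≡.sym (≡.trans (≡.cong (i +_) (owner-< d D (∈-upTo⁻ j<d))) (ℕ.+-identityʳ i))) refl
... | inj₂ e′ with ∈-++⁻ (spineEdge i D) e′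
catEdge⁻ i nxt (d ∷ _ ∷ D) _ | inj₂ _ | inj₁ (here refl) =
  spine ℕ.≤-refl (≡.subst (suc i <_) (≡.sym (ℕ.+-suc i (suc (length D)))) (s≤s (ℕ.m<m+n i (s≤s z≤n))))
... | inj₂ e″ = catEdge-shift (catEdge⁻ (suc i) (nxt + d) D e″)

spineEdge-∈ : ∀ {i} D → suc i < suc (i + length D) → (i , suc i) ∈ spineEdge i D
spineEdge-∈ {i} []      lt = ⊥-elim (ℕ.<-irrefl refl (≡.subst (suc i <_) (≡.cong suc (ℕ.+-identityʳ i)) lt))
spineEdge-∈     (_ ∷ _) _  = here refl

catEdge⁺ : ∀ i nxt D {a b} → CatEdge i nxt D a b → (a , b) ∈ catEdges i nxt (map suc D)
catEdge⁺ i nxt [] (spine {p} i≤p lt) =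
  ⊥-elim (ℕ.<-irrefl refl (ℕ.≤-<-trans i≤p (ℕ.<-trans (ℕ.n<1+n p) (≡.subst (suc p <_) (ℕ.+-identityʳ i) lt))))
catEdge⁺ i nxt (d ∷ D) c rewrite catEdges-∷ i nxt d D = onEdge c
  where
  Es = leafEdges i nxt d ++ spineEdge i D ++ catEdges (suc i) (nxt + d) (map suc D)
  rest : ∀ {a b} → CatEdge (suc i) (nxt + d) D a b → (a , b) ∈ Es
  rest c′ = ∈-++⁺ʳ (leafEdges i nxt d) (∈-++⁺ʳ (spineEdge i D) (catEdge⁺ (suc i) (nxt + d) D c′))
  onEdge : ∀ {a b} → CatEdge i nxt (d ∷ D) a b → (a , b) ∈ Es
  onEdge (spine {p} i≤p lt) with ℕ.m≤n⇒m<n∨m≡n i≤p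
  ... | inj₁ i<p = rest (spine i<p (≡.subst (suc p <_) (ℕ.+-suc i (length D)) lt))
  ... | inj₂ refl = ∈-++⁺ʳ (leafEdges i nxt d)
                      (∈-++⁺ˡ (spineEdge-∈ D (≡.subst (suc i <_) (ℕ.+-suc i (length D)) lt)))
  onEdge (leaf {t} lt refl refl) with offset d t
  ... | below t<d rewrite owner-< d D t<d | ℕ.+-identityʳ i = ∈-++⁺ˡ (∈-map⁺ _ (∈-upTo⁺ t<d))
  ... | above t′ = ≡.subst₂ (λ a b → (a , b) ∈ Es)
    (≡.sym (≡.trans (≡.cong (i +_) (owner-+ d D t′)) (ℕ.+-suc i (owner D t′))))
    (ℕ.+-assoc nxt d t′)
    (rest (leaf (ℕ.+-cancelˡ-< d t′ (sum D) lt) refl refl))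

touches : ℕ → ℕ × ℕ → Bool
touches v (a , b) = (a ≡ᵇ v) ∨ (b ≡ᵇ v)

touches-fst : ∀ a b → T (touches a (a , b))
touches-fst a b = from T-∨ (inj₁ (ℕ.≡⇒≡ᵇ a a refl))

touches-snd : ∀ a b → T (touches b (a , b))
touches-snd a b = from T-∨ (inj₂ (ℕ.≡⇒≡ᵇ b b refl))

untouched : ∀ {v a b} → a ≢ v → b ≢ v → ¬ T (touches v (a , b))
untouched {v} {a} {b} a≢v b≢v h with to T-∨ h
... | inj₁ a≡v = a≢v (ℕ.≡ᵇ⇒≡ a v a≡v)
... | inj₂ b≡v = b≢v (ℕ.≡ᵇ⇒≡ b v b≡v)

count-catEdges-∷ : ∀ (p : ℕ × ℕ → Bool) i nxt d D →
  count p (catEdges i nxt (map suc (d ∷ D))) ≡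
  count p (leafEdges i nxt d) + (count p (spineEdge i D) + count p (catEdges (suc i) (nxt + d) (map suc D)))
count-catEdges-∷ p i nxt d D =
  ≡.trans (≡.cong (count p) (catEdges-∷ i nxt d D))
    (≡.trans (count-++ p (leafEdges i nxt d) _) (≡.cong (count p (leafEdges i nxt d) +_) (count-++ p (spineEdge i D) _)))

catEdges-untouched : ∀ i nxt D {v} → i + length D ≤ v → v < nxt →
                     count (touches v) (catEdges i nxt (map suc D)) ≡ 0
catEdges-untouched i nxt D {v} le v<nxt =
  count-none (touches v) _ (λ { {a , b} e → untouched′ (catEdge⁻ i nxt D e) })
  where
  untouched′ : ∀ {a b} → CatEdge i nxt D a b → ¬ T (touches v (a , b))
  untouched′ (spine _ lt) =
    untouched (ℕ.<⇒≢ (ℕ.<-≤-trans (ℕ.<-trans (ℕ.n<1+n _) lt) le)) (ℕ.<⇒≢ (ℕ.<-≤-trans lt le))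
  untouched′ (leaf {t} lt refl refl) =
    untouched (ℕ.<⇒≢ (ℕ.<-≤-trans (ℕ.+-monoʳ-< i (owner<length D lt)) le))
              (ℕ.>⇒≢ (ℕ.<-≤-trans v<nxt (ℕ.m≤m+n nxt t)))

spineEdge-untouched : ∀ i D {v} → i + suc (length D) ≤ v → count (touches v) (spineEdge i D) ≡ 0
spineEdge-untouched i []      _  = refl
spineEdge-untouched i (_ ∷ D) {v} le = count-∷-false (touches v) {i , suc i} [] (untouched (ℕ.<⇒≢ i<v) (ℕ.<⇒≢ si<v))
  where
  si<v : suc i < v
  si<v = ℕ.<-≤-trans (≡.subst (suc i <_) (≡.sym (ℕ.+-suc i (suc (length D)))) (s≤s (ℕ.m<m+n i (s≤s z≤n)))) le
  i<v : i < v
  i<v = ℕ.<-trans (ℕ.n<1+n i) si<v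

leafEdges-touched : ∀ i nxt d {t} → i < nxt → t < d → count (touches (nxt + t)) (leafEdges i nxt d) ≡ 1
leafEdges-touched i nxt d {t} i<nxt t<d =
  ≡.trans (count-map (touches (nxt + t)) _ (upTo d))
    (count-applyUpTo-single _ (λ j → j) t<d (touches-snd i (nxt + t))
      (λ j≢t → untouched (ℕ.<⇒≢ (ℕ.<-≤-trans i<nxt (ℕ.m≤m+n nxt t))) (j≢t ∘ ℕ.+-cancelˡ-≡ nxt _ _)))

leafEdges-untouched : ∀ i nxt d {v} → i ≢ v → nxt + d ≤ v → count (touches v) (leafEdges i nxt d) ≡ 0
leafEdges-untouched i nxt d i≢v le = ≡.trans (count-map (touches _) _ (upTo d))
  (count-none _ (upTo d) (λ j<d → untouched i≢v (ℕ.<⇒≢ (ℕ.<-≤-trans (ℕ.+-monoʳ-< nxt (∈-upTo⁻ j<d)) le))))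

catEdges-leafDegree : ∀ i nxt D {t} → t < sum D → i + length D ≤ nxt →
                      count (touches (nxt + t)) (catEdges i nxt (map suc D)) ≡ 1
catEdges-leafDegree i nxt (d ∷ D) {t} lt le with offset d t
... | below t<d = ≡.trans (count-catEdges-∷ (touches (nxt + t)) i nxt d D)
  (≡.cong₂ _+_ (leafEdges-touched i nxt d i<nxt t<d)
    (≡.cong₂ _+_ (spineEdge-untouched i D (ℕ.≤-trans le (ℕ.m≤m+n nxt t)))
                 (catEdges-untouched (suc i) (nxt + d) D le′ (ℕ.+-monoʳ-< nxt t<d))))
  where
  i<nxt = ℕ.<-≤-trans (ℕ.m<m+n i (s≤s z≤n)) le
  le′   = ℕ.≤-trans (ℕ.≤-reflexive (≡.sym (ℕ.+-suc i (length D)))) (ℕ.≤-trans le (ℕ.m≤m+n nxt t))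
... | above t′ = ≡.trans (count-catEdges-∷ (touches (nxt + (d + t′))) i nxt d D)
  (≡.cong₂ _+_ (leafEdges-untouched i nxt d (ℕ.<⇒≢ (ℕ.<-≤-trans i<nxt (ℕ.m≤m+n nxt _)))
                                       (ℕ.+-monoʳ-≤ nxt (ℕ.m≤m+n d t′)))
    (≡.cong₂ _+_ (spineEdge-untouched i D (ℕ.≤-trans le (ℕ.m≤m+n nxt _)))
                 (≡.subst (λ v → count (touches v) (catEdges (suc i) (nxt + d) (map suc D)) ≡ 1)
                    (ℕ.+-assoc nxt d t′)
                    (catEdges-leafDegree (suc i) (nxt + d) D (ℕ.+-cancelˡ-< d t′ (sum D) lt) le′))))
  where
  i<nxt = ℕ.<-≤-trans (ℕ.m<m+n i (s≤s z≤n)) le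
  le′   = ℕ.≤-trans (ℕ.≤-reflexive (≡.sym (ℕ.+-suc i (length D)))) (ℕ.≤-trans le (ℕ.m≤m+n nxt d))

module Caterpillar (D : List ℕ) where

  G : Graph
  G = Cat (map suc D)

  K : ℕ
  K = length D

  size : N G ≡ K + sum D
  size = go D
    where
    go : ∀ D → sum (map suc D) ≡ length D + sum D
    go []      = refl
    go (d ∷ D) = ≡.cong suc (≡.trans (≡.cong (d +_) (go D)) (x∙yz≈y∙xz d (length D) (sum D)))

  edge⁻ : ∀ {a b} → (a , b) ∈ edges G → CatEdge 0 K D a b
  edge⁻ e = ≡.subst (λ n → CatEdge 0 n D _ _) (length-map suc D) (catEdge⁻ 0 _ D e)

  edge⁺ : ∀ {a b} → CatEdge 0 K D a b → (a , b) ∈ edges G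
  edge⁺ c = catEdge⁺ 0 _ D (≡.subst (λ n → CatEdge 0 n D _ _) (≡.sym (length-map suc D)) c)

  degree≡count : ∀ v → degree G v ≡ count (touches v) (edges G)
  degree≡count v = count-cong (edges G) (λ { (a , b) → refl })

  leaf-isLeaf : ∀ {t} → t < sum D → isLeaf G (K + t) ≡ true
  leaf-isLeaf {t} lt = ≡.cong (_≡ᵇ 1) (≡.trans (degree≡count (K + t))
    (≡.subst (λ n → count (touches (n + t)) (edges G) ≡ 1) (length-map suc D)
      (catEdges-leafDegree 0 _ D lt (ℕ.≤-reflexive (≡.sym (length-map suc D))))))

  twoEdges⇒nonLeaf : ∀ {p a b a′ b′} → CatEdge 0 K D a b → CatEdge 0 K D a′ b′ → (a , b) ≢ (a′ , b′) →
                     T (touches p (a , b)) → T (touches p (a′ , b′)) → isLeaf G p ≡ false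
  twoEdges⇒nonLeaf {p} c c′ ab≢ tp tp′ = ≡.trans (≡.cong (_≡ᵇ 1) (degree≡count p))
    (≥2 (∈⇒2≤count (touches p) (edge⁺ c) (edge⁺ c′) ab≢ tp tp′))
    where
    ≥2 : ∀ {n} → 2 ≤ n → (n ≡ᵇ 1) ≡ false
    ≥2 (s≤s (s≤s _)) = refl

LastPositive : List ℕ → Set
LastPositive []           = ⊥
LastPositive (d ∷ [])     = 1 ≤ d
LastPositive (_ ∷ d ∷ D)  = LastPositive (d ∷ D)

LeafyEnds : List ℕ → Set
LeafyEnds []           = ⊥
LeafyEnds (d ∷ [])     = 2 ≤ d
LeafyEnds (d ∷ d′ ∷ D) = 1 ≤ d × LastPositive (d′ ∷ D)

lastPositive⇒1≤sum : ∀ D → LastPositive D → 1 ≤ sum D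
lastPositive⇒1≤sum (d ∷ [])     1≤d = ℕ.≤-trans 1≤d (ℕ.m≤m+n d 0)
lastPositive⇒1≤sum (d ∷ d′ ∷ D) lp  = ℕ.≤-trans (lastPositive⇒1≤sum (d′ ∷ D) lp) (ℕ.m≤n+m _ d)

owner-last : ∀ D → LastPositive D → owner D (sum D ∸ 1) ≡ length D ∸ 1
owner-last (d ∷ [])     1≤d = owner-< d []
  (≡.subst (λ n → n ∸ 1 < d) (≡.sym (ℕ.+-identityʳ d)) (ℕ.∸-monoʳ-< {d} {1} {0} (s≤s z≤n) 1≤d))
owner-last (d ∷ d′ ∷ D) lp  = ≡.trans
  (≡.cong (owner (d ∷ d′ ∷ D)) (ℕ.+-∸-assoc d (lastPositive⇒1≤sum (d′ ∷ D) lp)))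
  (≡.trans (owner-+ d (d′ ∷ D) _) (≡.cong suc (owner-last (d′ ∷ D) lp)))

spine-nonLeaf : ∀ D → LeafyEnds D → ∀ {p} → p < length D → isLeaf (Cat (map suc D)) p ≡ false
spine-nonLeaf (d ∷ []) 2≤d {zero} _ =
  twoEdges⇒nonLeaf (leaf {t = 0} (ℕ.≤-trans 0<d d≤d+0) (≡.sym (owner-< d [] 0<d)) refl)
                   (leaf {t = 1} (ℕ.≤-trans 2≤d d≤d+0) (≡.sym (owner-< d [] 2≤d)) refl)
                   (λ ()) (touches-fst 0 1) (touches-fst 0 2)
  where
  open Caterpillar (d ∷ [])
  d≤d+0 = ℕ.m≤m+n d 0
  0<d = ℕ.<-trans (s≤s z≤n) 2≤d
spine-nonLeaf (d ∷ []) _ {suc p} (s≤s ())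
spine-nonLeaf (d ∷ d′ ∷ D) (1≤d , lp) {zero} _ =
  twoEdges⇒nonLeaf (spine {p = 0} z≤n (s≤s (s≤s z≤n)))
                   (leaf {t = 0} (ℕ.≤-trans 1≤d (ℕ.m≤m+n d _)) (≡.sym (owner-< d _ 1≤d)) refl)
                   (λ ()) (touches-fst 0 1) (touches-fst 0 (K + 0))
  where open Caterpillar (d ∷ d′ ∷ D)
spine-nonLeaf (d ∷ d′ ∷ D) (1≤d , lp) {suc q} p<K with ℕ.<-≤-connex (suc q) (length (d′ ∷ D))
... | inj₁ inner =
  twoEdges⇒nonLeaf (spine {p = q} z≤n p<K) (spine {p = suc q} z≤n (s≤s inner))
                   (λ eq → ℕ.<⇒≢ (ℕ.n<1+n q) (≡.cong proj₁ eq))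
                   (touches-snd q (suc q)) (touches-fst (suc q) (suc (suc q)))
  where open Caterpillar (d ∷ d′ ∷ D)
... | inj₂ last =
  twoEdges⇒nonLeaf (spine {p = q} z≤n p<K)
                   (leaf {t = sum (d ∷ d′ ∷ D) ∸ 1} t<sum
                         (≡.sym (≡.trans (owner-last (d ∷ d′ ∷ D) lp) (ℕ.≤-antisym last (ℕ.≤-pred p<K))))
                         refl)
                   (λ eq → ℕ.<⇒≢ (ℕ.<-≤-trans p<K (ℕ.m≤m+n K _)) (≡.cong proj₂ eq))
                   (touches-snd q (suc q)) (touches-fst (suc q) (K + (sum (d ∷ d′ ∷ D) ∸ 1)))
  where
  open Caterpillar (d ∷ d′ ∷ D)
  t<sum = ℕ.∸-monoʳ-< {_} {1} {0} (s≤s z≤n) (lastPositive⇒1≤sum (d ∷ d′ ∷ D) lp)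

leafyEnds⇒1≤sum : ∀ D → LeafyEnds D → 1 ≤ sum D
leafyEnds⇒1≤sum (d ∷ [])     2≤d      = ℕ.≤-trans (ℕ.<⇒≤ 2≤d) (ℕ.m≤m+n d 0)
leafyEnds⇒1≤sum (d ∷ d′ ∷ D) (_ , lp) = ℕ.≤-trans (lastPositive⇒1≤sum (d′ ∷ D) lp) (ℕ.m≤n+m _ d)

-- Subtrees of a caterpillar

validLeaves : List Bool → List (List Bool) → Bool
validLeaves (b ∷ s) (l ∷ ls) = (b ∨ allFalse l) ∧ validLeaves s ls
validLeaves _       _        = true

∨-allFalse : ∀ b l → (∀ t → T (mem l t) → T b) → T (b ∨ allFalse l)
∨-allFalse true  l h = _
∨-allFalse false l h = allFalse⇐ l h

validLeaves⇒ : ∀ s ls → length s ≡ length ls → T (validLeaves s ls) →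
               ∀ {t} → T (mem (concat ls) t) → T (mem s (owner (map length ls) t))
validLeaves⇒ (b ∷ s) (l ∷ ls) |s| v {t} m with to T-∧ v | offset (length l) t
... | bl , _ | below t<l with to T-∨ bl
...   | inj₁ tb = ≡.subst (T ∘ mem (b ∷ s)) (≡.sym (owner-< (length l) (map length ls) t<l)) tb
...   | inj₂ af = ⊥-elim (allFalse⇒ l af t (≡.subst T (mem-++ˡ l (concat ls) t<l) m))
validLeaves⇒ (b ∷ s) (l ∷ ls) |s| v m | _ , vs | above t′ =
  ≡.subst (T ∘ mem (b ∷ s)) (≡.sym (owner-+ (length l) (map length ls) t′))
    (validLeaves⇒ s ls (ℕ.suc-injective |s|) vs (≡.subst T (mem-++ʳ l (concat ls) t′) m))

validLeaves⇐ : ∀ s ls → (∀ {t} → T (mem (concat ls) t) → T (mem s (owner (map length ls) t))) →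
               T (validLeaves s ls)
validLeaves⇐ []      ls       h = _
validLeaves⇐ (b ∷ s) []       h = _
validLeaves⇐ (b ∷ s) (l ∷ ls) h = from T-∧ (∨-allFalse b l onHead , validLeaves⇐ s ls onTail)
  where
  onHead : ∀ t → T (mem l t) → T b
  onHead t m = ≡.subst (T ∘ mem (b ∷ s)) (owner-< (length l) (map length ls) (mem⇒< l m))
    (h (≡.subst T (≡.sym (mem-++ˡ l (concat ls) (mem⇒< l m))) m))
  onTail : ∀ {t} → T (mem (concat ls) t) → T (mem s (owner (map length ls) t))
  onTail {t} m = ≡.subst (T ∘ mem (b ∷ s)) (owner-+ (length l) (map length ls) t)
    (h (≡.subst T (≡.sym (mem-++ʳ l (concat ls) t)) m))

exactlyOne : Bool → Bool → Bool
exactlyOne u v = (u ∧ not v) ∨ (v ∧ not u)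

firstLink : (Bool → Bool → Bool) → Bool → List Bool → ℕ
firstLink f b []      = 0
firstLink f b (c ∷ _) = if f b c then 1 else 0

links : (Bool → Bool → Bool) → List Bool → ℕ
links f []      = 0
links f (b ∷ s) = firstLink f b s + links f s

edgeCount : (Bool → Bool → Bool) → List Bool → List (List Bool) → ℕ
edgeCount f (b ∷ s) (l ∷ ls) = count (f b) l + (firstLink f b s + edgeCount f s ls)
edgeCount f _       _        = 0

count-applyUpTo-mem : (p : ℕ → Bool) (q : Bool → Bool) (h : ℕ → ℕ) (l : List Bool) →
  (∀ {j} → j < length l → p (h j) ≡ q (mem l j)) → count p (applyUpTo h (length l)) ≡ count q l
count-applyUpTo-mem p q h []      e = refl
count-applyUpTo-mem p q h (b ∷ l) e rewrite e {0} (s≤s z≤n) with q b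
... | true  = ≡.cong suc (count-applyUpTo-mem p q (h ∘ suc) l (e ∘ s≤s))
... | false = count-applyUpTo-mem p q (h ∘ suc) l (e ∘ s≤s)

edgeWith : (Bool → Bool → Bool) → List Bool → ℕ × ℕ → Bool
edgeWith f S (a , b) = f (mem S a) (mem S b)

count-catEdges : ∀ f S i nxt s ls → length s ≡ length ls →
  (∀ {r} → r < length s → mem S (i + r) ≡ mem s r) →
  (∀ {r} → r < length (concat ls) → mem S (nxt + r) ≡ mem (concat ls) r) →
  count (edgeWith f S) (catEdges i nxt (map suc (map length ls))) ≡ edgeCount f s ls
count-catEdges f S i nxt []      []       _ _ _ = refl
count-catEdges f S i nxt (b ∷ s) (l ∷ ls) |s| onSpine onLeaves =
  ≡.trans (count-catEdges-∷ (edgeWith f S) i nxt (length l) (map length ls))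
    (≡.cong₂ _+_ leafBlock (≡.cong₂ _+_ (spineBlock s ls (ℕ.suc-injective |s|) onSpine) restBlock))
  where
  memS-i : mem S i ≡ b
  memS-i = ≡.trans (≡.cong (mem S) (≡.sym (ℕ.+-identityʳ i))) (onSpine (s≤s z≤n))
  leafBlock : count (edgeWith f S) (leafEdges i nxt (length l)) ≡ count (f b) l
  leafBlock = ≡.trans (count-map (edgeWith f S) _ (upTo (length l)))
    (count-applyUpTo-mem _ (f b) (λ j → j) l (λ {j} j<l → ≡.cong₂ f memS-i
      (≡.trans (onLeaves (ℕ.<-≤-trans j<l (≡.subst (length l ≤_) (≡.sym (length-++ l)) (ℕ.m≤m+n (length l) _))))
               (mem-++ˡ l (concat ls) j<l))))
  spineBlock : ∀ s ls → length s ≡ length ls → (∀ {r} → r < length (b ∷ s) → mem S (i + r) ≡ mem (b ∷ s) r) →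
               count (edgeWith f S) (spineEdge i (map length ls)) ≡ firstLink f b s
  spineBlock []      []      _ _ = refl
  spineBlock (c ∷ s) (_ ∷ _) _ h = ≡.cong (λ x → if x then 1 else 0)
    (≡.cong₂ f memS-i (≡.trans (≡.cong (mem S) (ℕ.+-comm 1 i)) (h (s≤s (s≤s z≤n)))))
  restBlock : count (edgeWith f S) (catEdges (suc i) (nxt + length l) (map suc (map length ls))) ≡ edgeCount f s ls
  restBlock = count-catEdges f S (suc i) (nxt + length l) s ls (ℕ.suc-injective |s|)
    (λ {r} lt → ≡.trans (≡.cong (mem S) (≡.sym (ℕ.+-suc i r))) (onSpine (s≤s lt)))
    (λ {r} lt → ≡.trans (≡.cong (mem S) (ℕ.+-assoc nxt (length l) r))
      (≡.trans (onLeaves (≡.subst (length l + r <_) (≡.sym (length-++ l)) (ℕ.+-monoʳ-< (length l) lt)))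
               (mem-++ʳ l (concat ls) r)))

module CaterpillarSubset (ls : List (List Bool)) (s : List Bool) (|s| : length s ≡ length ls) where

  open Caterpillar (map length ls)

  L : List Bool
  L = concat ls

  S : List Bool
  S = s ++ L

  |s|≡K : length s ≡ K
  |s|≡K = ≡.trans |s| (≡.sym (length-map length ls))

  |S| : length S ≡ N G
  |S| = ≡.trans (length-++ s) (≡.trans (≡.cong₂ _+_ |s|≡K (length-concat ls)) (≡.sym size))

  memS-spine : ∀ {p} → p < K → mem S p ≡ mem s p
  memS-spine lt = mem-++ˡ s L (≡.subst (_ <_) (≡.sym |s|≡K) lt)

  memS-leaf : ∀ t → mem S (K + t) ≡ mem L t
  memS-leaf t = ≡.subst (λ k → mem S (k + t) ≡ mem L t) |s|≡K (mem-++ʳ s L t)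

  inS : ∀ {p} → p < K → T (mem s p) → T (mem S p)
  inS lt = ≡.subst T (≡.sym (memS-spine lt))

  leafIndex< : ∀ {t} → T (mem S (K + t)) → t < sum (map length ls)
  leafIndex< {t} m = ℕ.+-cancelˡ-< K t _ (≡.subst (K + t <_) (≡.trans |S| size) (mem⇒< S m))

  edgeCount-correct : ∀ f → count (edgeWith f S) (edges G) ≡ edgeCount f s ls
  edgeCount-correct f = count-catEdges f S 0 _ s ls |s| (mem-++ˡ s L)
    (λ {r} _ → ≡.subst (λ k → mem S (k + r) ≡ mem L r) (≡.sym (length-map suc (map length ls))) (memS-leaf r))

  dS≡edgeCount : dS G S ≡ edgeCount exactlyOne s ls
  dS≡edgeCount = ≡.trans (count-cong (edges G) (λ { (a , b) → refl })) (edgeCount-correct exactlyOne)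

  eS≡edgeCount : eS G S ≡ edgeCount _∧_ s ls
  eS≡edgeCount = ≡.trans (count-cong (edges G) (λ { (a , b) → refl })) (edgeCount-correct _∧_)

  module SpineWalks (convex : Convex s) where

    spine-up : ∀ {m u a} k → T (mem s a) → T (mem s (k + a)) → k + a < K →
               T (reach G S m u a) → T (reach G S (k + m) u (k + a))
    spine-up zero    _  _  _  r = r
    spine-up {m} {a = a} (suc k) ma mk lt r =
      reach-step G S (k + m) (spine-up k ma mid lt′ r) (inS lt′ mid) (inS lt mk) (inj₁ (edge⁺ (spine z≤n lt)))
      where
      lt′ = ℕ.<-trans (ℕ.n<1+n _) lt
      mid = convex (ℕ.m≤n+m a k) (ℕ.n≤1+n _) ma mk

    spine-down : ∀ {m u a} k → T (mem s a) → T (mem s (k + a)) → k + a < K →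
                 T (reach G S m u (k + a)) → T (reach G S (k + m) u a)
    spine-down zero    _  _  _  r = r
    spine-down {m} {u} {a} (suc k) ma mk lt r = ≡.subst (λ n → T (reach G S n u a)) (ℕ.+-suc k m)
      (spine-down k ma mid lt′ (reach-step G S m r (inS lt mk) (inS lt′ mid) (inj₂ (edge⁺ (spine z≤n lt)))))
      where
      lt′ = ℕ.<-trans (ℕ.n<1+n _) lt
      mid = convex (ℕ.m≤n+m a k) (ℕ.n≤1+n _) ma mk

    spine-path : ∀ {m u a b} → a < K → b < K → T (mem s a) → T (mem s b) →
                 T (reach G S m u a) → T (reach G S (K ∸ 1 + m) u b)
    spine-path {m} {u} {a} {b} a<K b<K ma mb r with ℕ.≤-total a b
    ... | inj₁ a≤b = reach-mono G S (ℕ.+-monoˡ-≤ m (ℕ.≤-trans (ℕ.m∸n≤m b a) (ℕ.<⇒≤pred b<K)))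
      (≡.subst (λ x → T (reach G S (b ∸ a + m) u x)) (ℕ.m∸n+n≡m a≤b)
        (spine-up (b ∸ a) ma (≡.subst (T ∘ mem s) b≡ mb) (≡.subst (_< K) b≡ b<K) r))
      where b≡ = ≡.sym (ℕ.m∸n+n≡m a≤b)
    ... | inj₂ b≤a = reach-mono G S (ℕ.+-monoˡ-≤ m (ℕ.≤-trans (ℕ.m∸n≤m a b) (ℕ.<⇒≤pred a<K)))
      (spine-down (a ∸ b) mb (≡.subst (T ∘ mem s) a≡ ma) (≡.subst (_< K) a≡ a<K)
        (≡.subst (λ x → T (reach G S m u x)) a≡ r))
      where a≡ = ≡.sym (ℕ.m∸n+n≡m b≤a)

  record Anchored (x : ℕ) : Set where
    field
      anchor   : ℕ
      anchor<K : anchor < K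
      anchor∈s : T (mem s anchor)
      toAnchor   : ∀ {m u} → T (reach G S m u x) → T (reach G S (suc m) u anchor)
      fromAnchor : ∀ {m u} → T (reach G S m u anchor) → T (reach G S (suc m) u x)

  anchored : T (validLeaves s ls) → ∀ {x} → T (mem S x) → Anchored x
  anchored v {x} mx with offset K x
  ... | below x<K = record
    { anchor = x ; anchor<K = x<K ; anchor∈s = ≡.subst T (memS-spine x<K) mx
    ; toAnchor = λ {m} → reach-mono G S (ℕ.n≤1+n m) ; fromAnchor = λ {m} → reach-mono G S (ℕ.n≤1+n m) }
  ... | above t = record
    { anchor = o ; anchor<K = o<K ; anchor∈s = o∈s
    ; toAnchor   = λ {m} {u} r → reach-step G S m {u} r mx (inS o<K o∈s) (inj₂ e)
    ; fromAnchor = λ {m} {u} r → reach-step G S m {u} r (inS o<K o∈s) mx (inj₁ e) }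
    where
    t<sum = leafIndex< mx
    o = owner (map length ls) t
    o<K = owner<length (map length ls) t<sum
    o∈s = validLeaves⇒ s ls |s| v (≡.subst T (memS-leaf t) mx)
    e = edge⁺ (leaf t<sum refl refl)

  connected : T (isInterval s) → T (validLeaves s ls) → 1 ≤ sum (map length ls) → Connected G S
  connected int v 1≤sum {u} {w} mu mw =
    reach-mono G S bound (fromAnchor w′ {K ∸ 1 + 1} {u}
      (spine-path {1} {u} (anchor<K u′) (anchor<K w′) (anchor∈s u′) (anchor∈s w′)
        (toAnchor u′ {0} {u} (reach-refl G S 0 u))))
    where
    open Anchored
    open SpineWalks (proj₂ (isInterval⇒ s int))
    u′ = anchored v mu
    w′ = anchored v mw
    bound : suc (K ∸ 1 + 1) ≤ N G
    bound = ≡.subst₂ _≤_ (≡.cong suc (≡.sym (ℕ.m∸n+n≡m (ℕ.≤-trans (s≤s z≤n) (anchor<K u′)))))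
                         (≡.sym size) (≡.subst (_≤ K + sum (map length ls)) (ℕ.+-comm K 1) (ℕ.+-monoʳ-≤ K 1≤sum))

  ∉⇒≢ : ∀ {j y} → mem s j ≡ false → y < K → T (mem S y) → y ≢ j
  ∉⇒≢ j∉s y<K my refl = ≡.subst T (≡.trans (memS-spine y<K) j∉s) my

  spine∌leaf : ∀ {y t} → y < K → y ≢ K + t
  spine∌leaf {t = t} y<K = ℕ.<⇒≢ (ℕ.<-≤-trans y<K (ℕ.m≤m+n K t))

  BeforeOnSpine : ℕ → ℕ → Set
  BeforeOnSpine j y = (y < K → y < j) × (∀ {t} → y ≡ K + t → owner (map length ls) t < j)

  -- A spine vertex j outside s separates S: lying before j on the spine is preserved along S.
  beforeOnSpine-closed : ∀ {j} → mem s j ≡ false → EdgeClosed G S (BeforeOnSpine j)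
  beforeOnSpine-closed j∉s e ma mb with edge⁻ e
  ... | spine {a} _ sa<K =
      (λ qa → (λ _ → ℕ.≤∧≢⇒< (proj₁ qa a<K) (∉⇒≢ j∉s sa<K mb)) , (⊥-elim ∘ spine∌leaf sa<K))
    , (λ qb → (λ _ → ℕ.<-trans (ℕ.n<1+n a) (proj₁ qb sa<K)) , (⊥-elim ∘ spine∌leaf a<K))
    where a<K = ℕ.<-trans (ℕ.n<1+n a) sa<K
  ... | leaf {t′} lt refl refl =
      (λ qa → (λ lt′ → ⊥-elim (spine∌leaf lt′ refl))
            , (λ eq → ≡.subst (λ t → owner (map length ls) t < _) (ℕ.+-cancelˡ-≡ K t′ _ eq) (proj₁ qa o<K)))
    , (λ qb → (λ _ → proj₂ qb refl) , (⊥-elim ∘ spine∌leaf o<K))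
    where o<K = owner<length (map length ls) lt

  module Necessity (conn : Connected G S) {p : ℕ} (p<K : p < K) (p∈s : T (mem s p)) where

    spine< : ∀ {y} → T (mem s y) → y < K
    spine< m = ≡.subst (_ <_) |s|≡K (mem⇒< s m)

    isInterval-necessary : T (isInterval s)
    isInterval-necessary = isInterval⇐ s (p , p∈s) convex
      where
      convex : Convex s
      convex {i} {j} {k} i≤j j≤k mi mk with mem s j in j∉s
      ... | true  = _
      ... | false = ℕ.<-irrefl refl (ℕ.<-≤-trans (proj₁ before-k (spine< mk)) j≤k)
        where
        before-i : BeforeOnSpine j i
        before-i = (λ _ → ℕ.≤∧≢⇒< i≤j (∉⇒≢ j∉s (spine< mi) (inS (spine< mi) mi)))
                 , (⊥-elim ∘ spine∌leaf (spine< mi))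
        before-k : BeforeOnSpine j k
        before-k = reach-closed G S (beforeOnSpine-closed j∉s) (N G)
                     (conn (inS (spine< mi) mi) (inS (spine< mk) mk)) before-i

    validLeaves-necessary : T (validLeaves s ls)
    validLeaves-necessary = validLeaves⇐ s ls ownerIn
      where
      -- A leaf whose spine vertex is outside s is isolated in S.
      ownerIn : ∀ {t} → T (mem L t) → T (mem s (owner (map length ls) t))
      ownerIn {t} mt with mem s (owner (map length ls) t) in o∉s
      ... | true  = _
      ... | false = reach-closed G S closed (N G) (conn (inS p<K p∈s) mx) (spine∌leaf p<K) refl
        where
        mx : T (mem S (K + t))
        mx = ≡.subst T (≡.sym (memS-leaf t)) mt
        closed : EdgeClosed G S (_≢ K + t)
        closed e ma mb with edge⁻ e
        ... | spine {a} _ sa<K = (λ _ → spine∌leaf sa<K) , (λ _ → spine∌leaf (ℕ.<-trans (ℕ.n<1+n a) sa<K))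
        ... | leaf {t′} lt refl refl =
            (λ _ eq → ∉⇒≢ o∉s (owner<length (map length ls) lt) ma
                        (≡.cong (owner (map length ls)) (ℕ.+-cancelˡ-≡ K t′ t eq)))
          , (λ _ → spine∌leaf (owner<length (map length ls) lt))

  subtree⇔ : 1 ≤ sum (map length ls) → (∀ {p} → p < K → isLeaf G p ≡ false) →
             T (isSubtree G S ∧ hasNonLeaf G S) ⇔ T (isInterval s ∧ validLeaves s ls)
  subtree⇔ 1≤sum spineNonLeaf = mk⇔ ⇒ ⇐
    where
    ⇒ : T (isSubtree G S ∧ hasNonLeaf G S) → T (isInterval s ∧ validLeaves s ls)
    ⇒ h with sub , nonLeaf ← to T-∧ h
           with _ , conn ← to (isSubtree⇔ G S |S|) sub
           with v , mv , v-nonLeaf ← to (hasNonLeaf⇔ G S |S|) nonLeaf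
           with offset K v
    ... | below v<K = from T-∧ (isInterval-necessary , validLeaves-necessary)
      where open Necessity conn v<K (≡.subst T (memS-spine v<K) mv)
    ... | above t = ⊥-elim (≡.subst T (≡.trans (≡.sym (leaf-isLeaf (leafIndex< mv))) v-nonLeaf) _)
    ⇐ : T (isInterval s ∧ validLeaves s ls) → T (isSubtree G S ∧ hasNonLeaf G S)
    ⇐ h with int , v ← to T-∧ h with (p , p∈s) , _ ← isInterval⇒ s int = from T-∧
      ( from (isSubtree⇔ G S |S|) ((p , inS p<K p∈s) , connected int v 1≤sum)
      , from (hasNonLeaf⇔ G S |S|) (p , inS p<K p∈s , spineNonLeaf p<K))
      where p<K = ≡.subst (_ <_) |s|≡K (mem⇒< s p∈s)

-- Caterpillars of compositions and coarsenings

addToHead : ℕ → List ℕ → List ℕ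
addToHead n []      = []
addToHead n (g ∷ γ) = n + g ∷ γ

leafCounts : List ℕ → List ℕ
leafCounts []          = []
leafCounts (a ∷ [])    = a ∷ []
leafCounts (a ∷ b ∷ β) = a ∸ 1 ∷ leafCounts (b ∷ β)

leafCounts≢[] : ∀ b β → leafCounts (b ∷ β) ≢ []
leafCounts≢[] b []      ()
leafCounts≢[] b (_ ∷ _) ()

⊙1≡leafCounts : ∀ b β → All (1 ≤_) (b ∷ β) → (b ∷ β) ⊙ (1 ∷ []) ≡ map suc (leafCounts (b ∷ β))
⊙1≡leafCounts b       []      _               = ≡.cong (_∷ []) (ℕ.+-comm b 1)
⊙1≡leafCounts (suc b) (c ∷ β) (_ ∷ positive) = ≡.cong (suc b ∷_) (⊙1≡leafCounts c β positive)

1⊙α⊙1≡leafCounts : ∀ α → All (1 ≤_) α → 1 ≤ length α →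
                   (1 ∷ []) ⊙ (α ⊙ (1 ∷ [])) ≡ map suc (addToHead 1 (leafCounts α))
1⊙α⊙1≡leafCounts (a ∷ [])          _               _ = ≡.cong (λ n → suc n ∷ []) (ℕ.+-comm a 1)
1⊙α⊙1≡leafCounts (suc a ∷ b ∷ β) (_ ∷ positive) _ = ≡.cong (suc (suc a) ∷_) (⊙1≡leafCounts b β positive)

lastPositive-leafCounts : ∀ x b β → All (1 ≤_) (b ∷ β) → LastPositive (x ∷ leafCounts (b ∷ β))
lastPositive-leafCounts x b []      (1≤b ∷ [])     = 1≤b
lastPositive-leafCounts x b (c ∷ β) (_ ∷ positive) = lastPositive-leafCounts (b ∸ 1) c β positive

leafyEnds-leafCounts : ∀ α → All (1 ≤_) α → 1 ≤ length α → LeafyEnds (addToHead 1 (leafCounts α))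
leafyEnds-leafCounts (a ∷ [])          (1≤a ∷ [])     _ = s≤s 1≤a
leafyEnds-leafCounts (a ∷ b ∷ [])      (_ ∷ 1≤b ∷ []) _ = s≤s z≤n , 1≤b
leafyEnds-leafCounts (a ∷ b ∷ c ∷ β)  (_ ∷ _ ∷ positive) _ = s≤s z≤n , lastPositive-leafCounts (b ∸ 1) c β positive

coarsenings′ : List ℕ → List (List ℕ)
coarsenings′ []          = [] ∷ []
coarsenings′ (a ∷ [])    = (a ∷ []) ∷ []
coarsenings′ (a ∷ b ∷ β) = map (a ∷_) (coarsenings′ (b ∷ β)) ++ map (addToHead a) (coarsenings′ (b ∷ β))

data TailAtMost (n : ℕ) : List ℕ → Set where
  nonEmpty : ∀ {g γ} → length γ ≤ n → TailAtMost n (g ∷ γ)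

coarsenings′-tail : ∀ b β → All (TailAtMost (length β)) (coarsenings′ (b ∷ β))
coarsenings′-tail b []      = nonEmpty z≤n ∷ []
coarsenings′-tail b (c ∷ β) = ++⁺ (map⁺ (All.map (λ { (nonEmpty le) → nonEmpty (s≤s le) }) tails))
                                  (map⁺ (All.map (λ { (nonEmpty le) → nonEmpty (ℕ.m≤n⇒m≤1+n le) }) tails))
  where tails = coarsenings′-tail c β

record IsCoarsening (α γ : List ℕ) : Set where
  field
    sum≡     : sum γ ≡ sum α
    sums⊆    : ∀ s → All (_∈ partialSumsFrom s α) (partialSumsFrom s γ)
    positive : All (1 ≤_) γ

partialSumsFrom-above : ∀ s γ → All (1 ≤_) γ → All (s <_) (partialSumsFrom s γ)
partialSumsFrom-above s []      []         = []
partialSumsFrom-above s (g ∷ γ) (1≤g ∷ 1≤γ) =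
  s<s+g ∷ All.map (ℕ.<-trans s<s+g) (partialSumsFrom-above (s + g) γ 1≤γ)
  where s<s+g = ≡.subst (_≤ s + g) (ℕ.+-comm s 1) (ℕ.+-monoʳ-≤ s 1≤g)

All-∈-∷⁻ : ∀ {s ys xs} → All (s <_) xs → All (_∈ s ∷ ys) xs → All (_∈ ys) xs
All-∈-∷⁻ []         []                = []
All-∈-∷⁻ (s<x ∷ _)  (here refl ∷ _)   = ⊥-elim (ℕ.<-irrefl refl s<x)
All-∈-∷⁻ (_ ∷ s<xs) (there x∈ ∷ xs∈) = x∈ ∷ All-∈-∷⁻ s<xs xs∈

coarsenings′-sound : ∀ α {γ} → All (1 ≤_) α → γ ∈ coarsenings′ α → IsCoarsening α γ
coarsenings′-sound [] [] (here refl) = record { sum≡ = refl ; sums⊆ = λ _ → [] ; positive = [] }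
coarsenings′-sound (a ∷ []) (1≤a ∷ []) (here refl) =
  record { sum≡ = refl ; sums⊆ = λ s → here refl ∷ [] ; positive = 1≤a ∷ [] }
coarsenings′-sound (a ∷ b ∷ β) (1≤a ∷ positive) γ∈ with ∈-++⁻ (map (a ∷_) (coarsenings′ (b ∷ β))) γ∈
... | inj₁ γ∈₁ with γ′ , γ′∈ , refl ← ∈-map⁻ (a ∷_) γ∈₁ = record
  { sum≡     = ≡.cong (a +_) sum≡
  ; sums⊆    = λ s → here refl ∷ All.map there (sums⊆ (s + a))
  ; positive = 1≤a ∷ IsCoarsening.positive c }
  where
  c = coarsenings′-sound (b ∷ β) positive γ′∈
  open IsCoarsening c
... | inj₂ γ∈₂ with γ′ , γ′∈ , refl ← ∈-map⁻ (addToHead a) γ∈₂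
               with All.lookup (coarsenings′-tail b β) γ′∈
               |    coarsenings′-sound (b ∷ β) positive γ′∈
... | nonEmpty {g} {γ″} _ | record { sum≡ = sum≡ ; sums⊆ = sums⊆ ; positive = 1≤g ∷ 1≤γ″ } = record
  { sum≡     = ≡.trans (ℕ.+-assoc a g (sum γ″)) (≡.cong (a +_) sum≡)
  ; sums⊆    = λ s → ≡.subst (λ t → All (_∈ partialSumsFrom s (a ∷ b ∷ β)) (t ∷ partialSumsFrom t γ″))
                              (ℕ.+-assoc s a g) (All.map there (sums⊆ (s + a)))
  ; positive = ℕ.≤-trans 1≤g (ℕ.m≤n+m g a) ∷ 1≤γ″ }

coarsenings′-complete : ∀ s α γ → All (1 ≤_) α → All (1 ≤_) γ → 1 ≤ length α → sum γ ≡ sum α →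
                        All (_∈ partialSumsFrom s α) (partialSumsFrom s γ) → γ ∈ coarsenings′ α
coarsenings′-complete s (a ∷ α) [] (1≤a ∷ _) _ _ eq _ =
  ⊥-elim (ℕ.<⇒≢ (ℕ.≤-trans 1≤a (ℕ.m≤m+n a (sum α))) eq)
coarsenings′-complete s (a ∷ []) (g ∷ []) _ _ _ _ (here s+g≡s+a ∷ [])
  with refl ← ℕ.+-cancelˡ-≡ s g a s+g≡s+a = here refl
coarsenings′-complete s (a ∷ []) (g ∷ g′ ∷ γ) _ (_ ∷ 1≤g′ ∷ _) _ _ (here e ∷ here e′ ∷ _) =
  ⊥-elim (ℕ.<-irrefl (≡.trans e (≡.sym e′))
    (≡.subst (_≤ s + g + g′) (ℕ.+-comm (s + g) 1) (ℕ.+-monoʳ-≤ (s + g) 1≤g′)))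
coarsenings′-complete s (a ∷ b ∷ β) (g ∷ γ) (_ ∷ 1≤β) (_ ∷ 1≤γ) _ eq (here s+g≡s+a ∷ γ∈)
  with refl ← ℕ.+-cancelˡ-≡ s g a s+g≡s+a =
  ∈-++⁺ˡ (∈-map⁺ (a ∷_) (coarsenings′-complete (s + a) (b ∷ β) γ 1≤β 1≤γ (s≤s z≤n)
    (ℕ.+-cancelˡ-≡ a _ _ eq) (All-∈-∷⁻ (partialSumsFrom-above (s + a) γ 1≤γ) γ∈)))
coarsenings′-complete s (a ∷ b ∷ β) (g ∷ γ) (_ ∷ 1≤β) (_ ∷ 1≤γ) _ eq (there s+g∈ ∷ γ∈) =
  ≡.subst (_∈ coarsenings′ (a ∷ b ∷ β)) (≡.cong (_∷ γ) a+g′≡g)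
    (∈-++⁺ʳ (map (a ∷_) (coarsenings′ (b ∷ β))) (∈-map⁺ (addToHead a) g′∷γ∈))
  where
  a<g   = ℕ.+-cancelˡ-< s a g (All.lookup (partialSumsFrom-above (s + a) (b ∷ β) 1≤β) s+g∈)
  g′    = g ∸ a
  a+g′≡g : a + g′ ≡ g
  a+g′≡g = ℕ.m+[n∸m]≡n (ℕ.<⇒≤ a<g)
  sums : All (_∈ partialSumsFrom (s + a) (b ∷ β)) (partialSumsFrom (s + a) (g′ ∷ γ))
  sums rewrite ℕ.+-assoc s a g′ | a+g′≡g =
    s+g∈ ∷ All-∈-∷⁻ (All.map (ℕ.<-trans (ℕ.+-monoʳ-< s a<g)) (partialSumsFrom-above (s + g) γ 1≤γ)) γ∈
  g′∷γ∈ : g′ ∷ γ ∈ coarsenings′ (b ∷ β)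
  g′∷γ∈ = coarsenings′-complete (s + a) (b ∷ β) (g′ ∷ γ) 1≤β (ℕ.m<n⇒0<n∸m a<g ∷ 1≤γ) (s≤s z≤n)
    (ℕ.+-cancelˡ-≡ a _ _ (≡.trans (≡.sym (ℕ.+-assoc a g′ (sum γ))) (≡.trans (≡.cong (_+ sum γ) a+g′≡g) eq)))
    sums

listsOfLen-complete : ∀ n γ → All (1 ≤_) γ → All (_≤ n) γ → γ ∈ listsOfLen n (length γ)
listsOfLen-complete n []          []        []        = here refl
listsOfLen-complete n (suc i ∷ γ) (_ ∷ 1≤γ) (i<n ∷ γ≤n) =
  ∈-concatMap⁺ (λ i → map (suc i ∷_) (listsOfLen n (length γ)))
    (lose (∈-upTo⁺ i<n) (∈-map⁺ (suc i ∷_) (listsOfLen-complete n γ 1≤γ γ≤n)))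

listsOfLen-sound : ∀ n k {γ} → γ ∈ listsOfLen n k → All (1 ≤_) γ × length γ ≡ k
listsOfLen-sound n zero    (here refl) = [] , refl
listsOfLen-sound n (suc k) γ∈
  with i , _ , γ∈ᵢ ← find (∈-concatMap⁻ (λ i → map (suc i ∷_) (listsOfLen n k)) {xs = upTo n} γ∈)
  with γ′ , γ′∈ , refl ← ∈-map⁻ (suc i ∷_) γ∈ᵢ
  with 1≤γ′ , |γ′| ← listsOfLen-sound n k γ′∈ = s≤s z≤n ∷ 1≤γ′ , ≡.cong suc |γ′|

candidates-complete : ∀ γ → All (1 ≤_) γ → γ ∈ candidates (sum γ)
candidates-complete γ 1≤γ =
  ∈-concatMap⁺ (listsOfLen (sum γ))
    (lose (∈-upTo⁺ (s≤s (length≤sum γ 1≤γ))) (listsOfLen-complete (sum γ) γ 1≤γ (parts≤sum γ)))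
  where
  length≤sum : ∀ γ → All (1 ≤_) γ → length γ ≤ sum γ
  length≤sum []      []          = z≤n
  length≤sum (g ∷ γ) (1≤g ∷ 1≤γ) = ℕ.+-mono-≤ 1≤g (length≤sum γ 1≤γ)
  parts≤sum : ∀ γ → All (_≤ sum γ) γ
  parts≤sum []      = []
  parts≤sum (g ∷ γ) = ℕ.m≤m+n g (sum γ) ∷ All.map (λ le → ℕ.≤-trans le (ℕ.m≤n+m (sum γ) g)) (parts≤sum γ)

candidates-positive : ∀ n {γ} → γ ∈ candidates n → All (1 ≤_) γ
candidates-positive n γ∈ with k , _ , γ∈ₖ ← find (∈-concatMap⁻ (listsOfLen n) {xs = upTo (suc n)} γ∈) =
  proj₁ (listsOfLen-sound n k γ∈ₖ)

listsOfLen-unique : ∀ n k → Unique (listsOfLen n k)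
listsOfLen-unique n zero    = [] ∷ []
listsOfLen-unique n (suc k) =
  Unique.concat⁺ (map⁺ (universal (λ i → Unique.map⁺ ∷-injectiveʳ (listsOfLen-unique n k)) (upTo n)))
                 (AllPairs.map⁺ (AllPairs.applyUpTo⁺₁ (λ i → i) n disjoint))
  where
  disjoint : ∀ {i j} → i < j → j < n → Disjoint (map (suc i ∷_) (listsOfLen n k)) (map (suc j ∷_) (listsOfLen n k))
  disjoint i<j _ (γ∈ᵢ , γ∈ⱼ) with _ , _ , refl ← ∈-map⁻ _ γ∈ᵢ | _ , _ , eq ← ∈-map⁻ _ γ∈ⱼ =
    ℕ.<-irrefl (ℕ.suc-injective (∷-injectiveˡ eq)) i<j

candidates-unique : ∀ n → Unique (candidates n)
candidates-unique n =
  Unique.concat⁺ (map⁺ (universal (listsOfLen-unique n) (upTo (suc n))))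
                 (AllPairs.map⁺ (AllPairs.applyUpTo⁺₁ (λ i → i) (suc n) disjoint))
  where
  disjoint : ∀ {i j} → i < j → j < suc n → Disjoint (listsOfLen n i) (listsOfLen n j)
  disjoint i<j _ (γ∈ᵢ , γ∈ⱼ) =
    ℕ.<-irrefl (≡.trans (≡.sym (proj₂ (listsOfLen-sound n _ γ∈ᵢ))) (proj₂ (listsOfLen-sound n _ γ∈ⱼ))) i<j

addToHead-injective : ∀ a {γ δ} → addToHead a γ ≡ addToHead a δ → γ ≡ δ
addToHead-injective a {[]}    {[]}    _  = refl
addToHead-injective a {g ∷ γ} {h ∷ δ} eq
  with refl ← ℕ.+-cancelˡ-≡ a g h (∷-injectiveˡ eq) | refl ← ∷-injectiveʳ eq = refl

coarsenings′-unique : ∀ α → All (1 ≤_) α → Unique (coarsenings′ α)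
coarsenings′-unique []          _              = [] ∷ []
coarsenings′-unique (a ∷ [])    _              = [] ∷ []
coarsenings′-unique (a ∷ b ∷ β) (_ ∷ positive) =
  Unique.++⁺ (Unique.map⁺ ∷-injectiveʳ unique) (Unique.map⁺ (addToHead-injective a) unique) disjoint
  where
  unique = coarsenings′-unique (b ∷ β) positive
  disjoint : Disjoint (map (a ∷_) (coarsenings′ (b ∷ β))) (map (addToHead a) (coarsenings′ (b ∷ β)))
  disjoint (γ∈₁ , γ∈₂) with _ , _ , refl ← ∈-map⁻ (a ∷_) γ∈₁ | γ , γ∈ , eq ← ∈-map⁻ (addToHead a) γ∈₂
    with nonEmpty {g} _ ← All.lookup (coarsenings′-tail b β) γ∈
    with 1≤g ∷ _ ← IsCoarsening.positive (coarsenings′-sound (b ∷ β) positive γ∈) =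
    ℕ.<-irrefl (∷-injectiveˡ eq) (≡.subst (_≤ a + g) (ℕ.+-comm a 1) (ℕ.+-monoʳ-≤ a 1≤g))

coarsenings↭coarsenings′ : ∀ α → All (1 ≤_) α → 1 ≤ length α → coarsenings α ↭ coarsenings′ α
coarsenings↭coarsenings′ α positive 1≤ℓ = ∼bag⇒↭ (unique∧set⇒bag
  (Unique.filter⁺ (≽-dec α) (candidates-unique (sum α))) (coarsenings′-unique α positive)
  (mk⇔ complete sound))
  where
  complete : ∀ {γ} → γ ∈ coarsenings α → γ ∈ coarsenings′ α
  complete γ∈ with γ∈c , (sum≡ , sums⊆) ← ∈-filter⁻ (≽-dec α) {xs = candidates (sum α)} γ∈ =
    coarsenings′-complete 0 α _ positive (candidates-positive (sum α) γ∈c) 1≤ℓ sum≡ sums⊆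
  sound : ∀ {γ} → γ ∈ coarsenings′ α → γ ∈ coarsenings α
  sound {γ} γ∈ = ∈-filter⁺ (≽-dec α)
    (≡.subst (λ n → γ ∈ candidates n) sum≡ (candidates-complete γ (IsCoarsening.positive c))) (sum≡ , sums⊆ 0)
    where
    c = coarsenings′-sound α positive γ∈
    open IsCoarsening c

-- Interval sums and coarsening sums

module Polynomials {a ℓ : Level} (R : CommutativeSemiring a ℓ) (y z : CommutativeSemiring.Carrier R) where

  open CommutativeSemiring R renaming (_+_ to _⊕_; _*_ to _⊛_; refl to ≈-refl)
  open FiniteSums R
  open import Relation.Binary.Reasoning.Setoid setoid
  open import Algebra.Solver.Ring.NaturalCoefficients.Default R

  w : Carrier
  w = y ⊕ z

  infixr 8 _^_
  _^_ : Carrier → ℕ → Carrier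
  x ^ n = pow R x n

  leafWeight : List Bool → List ℕ → Carrier
  leafWeight (b ∷ s) (d ∷ D) = (if b then w ^ d else 1#) ⊛ leafWeight s D
  leafWeight _       _       = 1#

  spineWeight : List Bool → List ℕ → Carrier
  spineWeight s D = (y ^ links exactlyOne s ⊛ z ^ links _∧_ s) ⊛ leafWeight s D

  intervalSum : List ℕ → Carrier
  intervalSum D = Σ R (subsets (length D)) (λ s → when (isInterval s) (spineWeight s D))

  spineWeight-∷ : ∀ b s d D → spineWeight (b ∷ s) (d ∷ D) ≈
    (y ^ firstLink exactlyOne b s ⊛ z ^ firstLink _∧_ b s) ⊛ ((if b then w ^ d else 1#) ⊛ spineWeight s D)
  spineWeight-∷ b s d D = begin
    (y ^ (firstLink exactlyOne b s + links exactlyOne s) ⊛ z ^ (firstLink _∧_ b s + links _∧_ s)) ⊛ (W ⊛ leafWeight s D)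
      ≈⟨ *-congʳ (*-cong (pow-+ y (firstLink exactlyOne b s) _) (pow-+ z (firstLink _∧_ b s) _)) ⟩
    ((y ^ firstLink exactlyOne b s ⊛ y ^ links exactlyOne s) ⊛ (z ^ firstLink _∧_ b s ⊛ z ^ links _∧_ s))
      ⊛ (W ⊛ leafWeight s D)
      ≈⟨ solve 6 (λ a₁ a₂ a₃ a₄ a₅ a₆ → ((a₁ :* a₂) :* (a₃ :* a₄)) :* (a₅ :* a₆)
                                     := (a₁ :* a₃) :* (a₅ :* ((a₂ :* a₄) :* a₆))) ≈-refl _ _ _ _ _ _ ⟩
    (y ^ firstLink exactlyOne b s ⊛ z ^ firstLink _∧_ b s) ⊛ (W ⊛ spineWeight s D) ∎
    where W = if b then w ^ d else 1#

  leafTerm : Bool → List Bool → Carrier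
  leafTerm b l = y ^ count (exactlyOne b) l ⊛ z ^ count (b ∧_) l

  leafSum : ∀ b d → Σ R (subsets d) (λ l → when (b ∨ allFalse l) (leafTerm b l)) ≈ (if b then w ^ d else 1#)
  leafSum true  zero    = trans (+-identityʳ _) (*-identityˡ 1#)
  leafSum true  (suc d) = begin
    Σ R (subsets (suc d)) (leafTerm true)
      ≈⟨ Σ-subsets-suc d _ ⟩
    Σ R (subsets d) (λ l → y ^ count (exactlyOne true) l ⊛ (z ⊛ z ^ count (true ∧_) l)) ⊕
    Σ R (subsets d) (λ l → (y ⊛ y ^ count (exactlyOne true) l) ⊛ z ^ count (true ∧_) l)
      ≈⟨ +-cong (trans (Σ-cong (subsets d) (λ l → solve 3 (λ a b c → a :* (b :* c) := b :* (a :* c)) ≈-refl _ z _))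
                       (Σ-*ˡ (subsets d) z _))
                (trans (Σ-cong (subsets d) (λ l → *-assoc y _ _)) (Σ-*ˡ (subsets d) y _)) ⟩
    z ⊛ Σ R (subsets d) (leafTerm true) ⊕ y ⊛ Σ R (subsets d) (leafTerm true)
      ≈⟨ +-cong (*-congˡ (leafSum true d)) (*-congˡ (leafSum true d)) ⟩
    z ⊛ w ^ d ⊕ y ⊛ w ^ d
      ≈⟨ solve 3 (λ y z p → z :* p :+ y :* p := (y :+ z) :* p) ≈-refl y z _ ⟩
    w ^ suc d ∎
  leafSum false d = begin
    Σ R (subsets d) (λ l → when (allFalse l) (leafTerm false l))
      ≈⟨ Σ-subsets-allFalse d (leafTerm false) ⟩
    y ^ count (exactlyOne false) (replicate d false) ⊛ z ^ count (false ∧_) (replicate d false)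
      ≡⟨ ≡.cong₂ (λ m n → y ^ m ⊛ z ^ n) (count-replicate (exactlyOne false) (λ ()) d)
                                          (count-replicate (false ∧_) (λ ()) d) ⟩
    1# ⊛ 1#
      ≈⟨ *-identityˡ 1# ⟩
    1# ∎

  leavesTerm : List Bool → List (List Bool) → Carrier
  leavesTerm s ls = when (validLeaves s ls) (y ^ edgeCount exactlyOne s ls ⊛ z ^ edgeCount _∧_ s ls)

  Σ-leaves : ∀ s D → length s ≡ length D → Σ R (blockSubsets D) (leavesTerm s) ≈ spineWeight s D
  Σ-leaves []      []      _   = solve 0 ((con 1 :* con 1) :+ con 0 := (con 1 :* con 1) :* con 1) ≈-refl
  Σ-leaves (b ∷ s) (d ∷ D) |s| = begin
    Σ R (blockSubsets (d ∷ D)) (leavesTerm (b ∷ s))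
      ≈⟨ Σ-concatMap (λ l → map (l ∷_) (blockSubsets D)) (subsets d) _ ⟩
    Σ R (subsets d) (λ l → Σ R (map (l ∷_) (blockSubsets D)) (leavesTerm (b ∷ s)))
      ≈⟨ Σ-cong (subsets d) (λ l → reflexive (Σ-map (l ∷_) (blockSubsets D) _)) ⟩
    Σ R (subsets d) (λ l → Σ R (blockSubsets D) (λ ls → leavesTerm (b ∷ s) (l ∷ ls)))
      ≈⟨ Σ-cong (subsets d) (λ l → Σ-cong (blockSubsets D) (λ ls →
           when-∧ (b ∨ allFalse l) (validLeaves s ls) (split l ls))) ⟩
    Σ R (subsets d) (λ l → Σ R (blockSubsets D) (λ ls → A l ⊛ (B ⊛ leavesTerm s ls)))
      ≈⟨ Σ-cong (subsets d) (λ l → trans (Σ-*ˡ (blockSubsets D) (A l) _) (*-congˡ (Σ-*ˡ (blockSubsets D) B _))) ⟩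
    Σ R (subsets d) (λ l → A l ⊛ (B ⊛ Σ R (blockSubsets D) (leavesTerm s)))
      ≈⟨ Σ-*ʳ (subsets d) _ A ⟩
    Σ R (subsets d) A ⊛ (B ⊛ Σ R (blockSubsets D) (leavesTerm s))
      ≈⟨ *-cong (leafSum b d) (*-congˡ (Σ-leaves s D (ℕ.suc-injective |s|))) ⟩
    (if b then w ^ d else 1#) ⊛ (B ⊛ spineWeight s D)
      ≈⟨ solve 3 (λ p q r → p :* (q :* r) := q :* (p :* r)) ≈-refl _ _ _ ⟩
    B ⊛ ((if b then w ^ d else 1#) ⊛ spineWeight s D)
      ≈⟨ sym (spineWeight-∷ b s d D) ⟩
    spineWeight (b ∷ s) (d ∷ D) ∎
    where
    A : List Bool → Carrier
    A l = when (b ∨ allFalse l) (leafTerm b l)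
    B = y ^ firstLink exactlyOne b s ⊛ z ^ firstLink _∧_ b s
    split : ∀ l ls → y ^ edgeCount exactlyOne (b ∷ s) (l ∷ ls) ⊛ z ^ edgeCount _∧_ (b ∷ s) (l ∷ ls) ≈
                     leafTerm b l ⊛ (B ⊛ (y ^ edgeCount exactlyOne s ls ⊛ z ^ edgeCount _∧_ s ls))
    split l ls = trans
      (*-cong (trans (pow-+ y (count (exactlyOne b) l) _) (*-congˡ (pow-+ y (firstLink exactlyOne b s) _)))
              (trans (pow-+ z (count (b ∧_) l) _) (*-congˡ (pow-+ z (firstLink _∧_ b s) _))))
      (solve 6 (λ a₁ a₂ a₃ c₁ c₂ c₃ → (a₁ :* (a₂ :* a₃)) :* (c₁ :* (c₂ :* c₃))
                                   := (a₁ :* c₁) :* ((a₂ :* c₂) :* (a₃ :* c₃))) ≈-refl _ _ _ _ _ _)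

  subtreeTerm : Graph → List Bool → Carrier
  subtreeTerm G S = when (isSubtree G S ∧ hasNonLeaf G S) (y ^ dS G S ⊛ z ^ eS G S)

  subtreeTerm-caterpillar : ∀ D ls s → map length ls ≡ D → length s ≡ length D → LeafyEnds D →
    subtreeTerm (Cat (map suc D)) (s ++ concat ls) ≡
    when (isInterval s ∧ validLeaves s ls) (y ^ edgeCount exactlyOne s ls ⊛ z ^ edgeCount _∧_ s ls)
  subtreeTerm-caterpillar .(map length ls) ls s refl |s| ends = go (≡.trans |s| (length-map length ls))
    where
    go : length s ≡ length ls → subtreeTerm (Cat (map suc (map length ls))) (s ++ concat ls) ≡
         when (isInterval s ∧ validLeaves s ls) (y ^ edgeCount exactlyOne s ls ⊛ z ^ edgeCount _∧_ s ls)
    go |s|′ rewrite T-injective (CaterpillarSubset.subtree⇔ ls s |s|′ (leafyEnds⇒1≤sum _ ends) (spine-nonLeaf _ ends))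
                  | CaterpillarSubset.dS≡edgeCount ls s |s|′
                  | CaterpillarSubset.eS≡edgeCount ls s |s|′ = refl

  hbar≈intervalSum : ∀ D → LeafyEnds D → Hbar R (Cat (map suc D)) y z ≈ intervalSum D
  hbar≈intervalSum D ends = begin
    Σ R (subsets (N G)) (subtreeTerm G)
      ≡⟨ ≡.cong (λ n → Σ R (subsets n) (subtreeTerm G)) size ⟩
    Σ R (subsets (length D + sum D)) (subtreeTerm G)
      ≈⟨ Σ-subsets-+ (length D) (sum D) _ ⟩
    Σ R (subsets (length D)) (λ s → Σ R (subsets (sum D)) (λ L → subtreeTerm G (s ++ L)))
      ≈⟨ Σ-congᴬ (All.map (λ {s} |s| → trans (Σ-blockSubsets D _) (intervalTerm s |s|)) (subsets-length (length D))) ⟩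
    intervalSum D ∎
    where
    open Caterpillar D using (G; size)
    intervalTerm : ∀ s → length s ≡ length D →
                   Σ R (blockSubsets D) (λ ls → subtreeTerm G (s ++ concat ls)) ≈ when (isInterval s) (spineWeight s D)
    intervalTerm s |s| = begin
      Σ R (blockSubsets D) (λ ls → subtreeTerm G (s ++ concat ls))
        ≈⟨ Σ-congᴬ (All.map (λ {ls} |ls| → reflexive (subtreeTerm-caterpillar D ls s |ls| |s| ends))
                            (blockSubsets-lengths D)) ⟩
      Σ R (blockSubsets D) (λ ls → when (isInterval s ∧ validLeaves s ls) _)
        ≈⟨ Σ-when-∧ (isInterval s) (blockSubsets D) (validLeaves s) _ ⟩
      when (isInterval s) (Σ R (blockSubsets D) (leavesTerm s))
        ≈⟨ when-cong (isInterval s) (Σ-leaves s D |s|) ⟩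
      when (isInterval s) (spineWeight s D) ∎

  prefixSum : ℕ → List ℕ → Carrier
  prefixSum d ds = Σ R (subsets (length ds)) (λ s → when (isInitialSegment s) (spineWeight (true ∷ s) (d ∷ ds)))

  -- Intervals of a spine preceded by one more vertex, which is not in the interval.
  laterSum : List ℕ → Carrier
  laterSum ds = Σ R (subsets (length ds)) (λ s → when (isInterval s) (y ^ firstLink exactlyOne false s ⊛ spineWeight s ds))

  spineWeight-false : ∀ s d ds → spineWeight (false ∷ s) (d ∷ ds) ≈ y ^ firstLink exactlyOne false s ⊛ spineWeight s ds
  spineWeight-false s d ds = trans (spineWeight-∷ false s d ds) (lemma s)
    where
    lemma : ∀ s → (y ^ firstLink exactlyOne false s ⊛ z ^ firstLink _∧_ false s) ⊛ (1# ⊛ spineWeight s ds)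
                  ≈ y ^ firstLink exactlyOne false s ⊛ spineWeight s ds
    lemma []      = solve 2 (λ a b → (a :* con 1) :* (con 1 :* b) := a :* b) ≈-refl _ _
    lemma (_ ∷ _) = solve 2 (λ a b → (a :* con 1) :* (con 1 :* b) := a :* b) ≈-refl _ _

  spineWeight-+ : ∀ g s d ds → spineWeight (true ∷ s) (g + d ∷ ds) ≈ w ^ g ⊛ spineWeight (true ∷ s) (d ∷ ds)
  spineWeight-+ g s d ds = trans (*-congˡ (*-congʳ (pow-+ w g d)))
    (solve 4 (λ l a b r → l :* ((a :* b) :* r) := a :* (l :* (b :* r))) ≈-refl _ _ _ _)

  spineWeight-allFalse : ∀ n ds → spineWeight (replicate n false) ds ≈ 1#
  spineWeight-allFalse n ds = trans (*-cong (reflexive (≡.cong₂ (λ m k → y ^ m ⊛ z ^ k) (links-allFalse exactlyOne refl n)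
                                                                                  (links-allFalse _∧_ refl n)))
                                           (leafWeight-allFalse n ds))
                                    (trans (*-identityʳ _) (*-identityˡ 1#))
    where
    links-allFalse : ∀ f → f false false ≡ false → ∀ n → links f (replicate n false) ≡ 0
    links-allFalse f e zero          = refl
    links-allFalse f e (suc zero)    = refl
    links-allFalse f e (suc (suc n)) = ≡.cong₂ _+_ (≡.cong (λ b → if b then 1 else 0) e) (links-allFalse f e (suc n))
    leafWeight-allFalse : ∀ n ds → leafWeight (replicate n false) ds ≈ 1#
    leafWeight-allFalse zero    ds       = ≈-refl
    leafWeight-allFalse (suc n) []       = ≈-refl
    leafWeight-allFalse (suc n) (d ∷ ds) = trans (*-identityˡ _) (leafWeight-allFalse n ds)

  prefixSum-[] : ∀ d → prefixSum d [] ≈ w ^ d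
  prefixSum-[] d = solve 1 (λ p → (con 1 :* con 1) :* (p :* con 1) :+ con 0 := p) ≈-refl (w ^ d)

  prefixSum-∷ : ∀ d d′ ds → prefixSum d (d′ ∷ ds) ≈ w ^ d ⊛ (y ⊕ z ⊛ prefixSum d′ ds)
  prefixSum-∷ d d′ ds = begin
    prefixSum d (d′ ∷ ds)
      ≈⟨ Σ-subsets-suc (length ds) _ ⟩
    Σ R (subsets (length ds)) (λ s → when (isInitialSegment s) (spineWeight (true ∷ true ∷ s) (d ∷ d′ ∷ ds))) ⊕
    Σ R (subsets (length ds)) (λ s → when (allFalse s) (spineWeight (true ∷ false ∷ s) (d ∷ d′ ∷ ds)))
      ≈⟨ +-cong (Σ-cong (subsets (length ds)) (λ s →
                   trans (when-cong (isInitialSegment s) (extend s)) (when-*ˡ (isInitialSegment s) _ _)))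
                (Σ-subsets-allFalse (length ds) _) ⟩
    Σ R (subsets (length ds)) (λ s → (w ^ d ⊛ z) ⊛ when (isInitialSegment s) (spineWeight (true ∷ s) (d′ ∷ ds))) ⊕
    spineWeight (true ∷ false ∷ replicate (length ds) false) (d ∷ d′ ∷ ds)
      ≈⟨ +-cong (Σ-*ˡ (subsets (length ds)) _ _)
                (trans (spineWeight-∷ true (false ∷ replicate (length ds) false) d (d′ ∷ ds))
                       (*-congˡ (*-congˡ (spineWeight-allFalse (suc (length ds)) (d′ ∷ ds))))) ⟩
    (w ^ d ⊛ z) ⊛ prefixSum d′ ds ⊕ (y ^ 1 ⊛ z ^ 0) ⊛ (w ^ d ⊛ 1#)
      ≈⟨ solve 4 (λ p z Y y → (p :* z) :* Y :+ ((y :* con 1) :* con 1) :* (p :* con 1) := p :* (y :+ z :* Y))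
                 ≈-refl (w ^ d) z (prefixSum d′ ds) y ⟩
    w ^ d ⊛ (y ⊕ z ⊛ prefixSum d′ ds) ∎
    where
    extend : ∀ s → spineWeight (true ∷ true ∷ s) (d ∷ d′ ∷ ds) ≈
                   (w ^ d ⊛ z) ⊛ spineWeight (true ∷ s) (d′ ∷ ds)
    extend s = trans (spineWeight-∷ true (true ∷ s) d (d′ ∷ ds))
      (solve 3 (λ a b c → (con 1 :* (a :* con 1)) :* (b :* c) := (b :* a) :* c) ≈-refl z (w ^ d) _)

  laterSum-[] : laterSum [] ≈ 0#
  laterSum-[] = +-identityʳ _

  laterSum-∷ : ∀ d ds → laterSum (d ∷ ds) ≈ y ⊛ prefixSum d ds ⊕ laterSum ds
  laterSum-∷ d ds = begin
    laterSum (d ∷ ds)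
      ≈⟨ Σ-subsets-suc (length ds) _ ⟩
    Σ R (subsets (length ds)) (λ s → when (isInitialSegment s) (y ^ 1 ⊛ spineWeight (true ∷ s) (d ∷ ds))) ⊕
    Σ R (subsets (length ds)) (λ s → when (isInterval s) (y ^ 0 ⊛ spineWeight (false ∷ s) (d ∷ ds)))
      ≈⟨ +-cong (trans (Σ-cong (subsets (length ds)) (λ s → when-*ˡ (isInitialSegment s) _ _))
                       (Σ-*ˡ (subsets (length ds)) _ _))
                (Σ-cong (subsets (length ds)) (λ s → when-cong (isInterval s)
                   (trans (*-identityˡ _) (spineWeight-false s d ds)))) ⟩
    y ^ 1 ⊛ prefixSum d ds ⊕ laterSum ds
      ≈⟨ +-congʳ (*-congʳ (*-identityʳ y)) ⟩
    y ⊛ prefixSum d ds ⊕ laterSum ds ∎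

  intervalSum-+ : ∀ g d ds → intervalSum (g + d ∷ ds) ≈ w ^ g ⊛ prefixSum d ds ⊕ laterSum ds
  intervalSum-+ g d ds = begin
    intervalSum (g + d ∷ ds)
      ≈⟨ Σ-subsets-suc (length ds) _ ⟩
    prefixSum (g + d) ds ⊕ Σ R (subsets (length ds)) (λ s → when (isInterval s) (spineWeight (false ∷ s) (g + d ∷ ds)))
      ≈⟨ +-cong (trans (Σ-cong (subsets (length ds)) (λ s → trans (when-cong (isInitialSegment s) (spineWeight-+ g s d ds))
                                                                    (when-*ˡ (isInitialSegment s) _ _)))
                       (Σ-*ˡ (subsets (length ds)) _ _))
                (Σ-cong (subsets (length ds)) (λ s → when-cong (isInterval s) (spineWeight-false s (g + d) ds))) ⟩
    w ^ g ⊛ prefixSum d ds ⊕ laterSum ds ∎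

  -- Hnum of α with e added to its first part, unfolded by whether a coarsening keeps the first cut.
  Hnum⁺ : ℕ → List ℕ → Carrier
  Hnum⁺ e []          = 0#
  Hnum⁺ e (a ∷ [])    = w ^ suc (e + a)
  Hnum⁺ e (a ∷ b ∷ β) = y ⊛ (w ^ suc (e + a) ⊛ w ^ length β ⊕ Hnum⁺ 0 (b ∷ β)) ⊕ z ⊛ Hnum⁺ (e + a) (b ∷ β)

  intervalSum-leafCounts : ∀ e α → All (1 ≤_) α → 1 ≤ length α →
    w ^ (length α ∸ 1) ⊛ intervalSum (addToHead (suc e) (leafCounts α)) ≈ Hnum⁺ e α
  intervalSum-leafCounts e (a ∷ []) _ _ = begin
    1# ⊛ intervalSum (suc e + a ∷ [])
      ≈⟨ *-identityˡ _ ⟩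
    intervalSum (suc e + a ∷ [])
      ≈⟨ intervalSum-+ (suc e) a [] ⟩
    w ^ suc e ⊛ prefixSum a [] ⊕ laterSum []
      ≈⟨ +-cong (*-congˡ (prefixSum-[] a)) laterSum-[] ⟩
    w ^ suc e ⊛ w ^ a ⊕ 0#
      ≈⟨ trans (+-identityʳ _) (sym (pow-+ w (suc e) a)) ⟩
    w ^ suc (e + a) ∎
  intervalSum-leafCounts e (suc a ∷ b ∷ β) (_ ∷ positive) _
    with leafCounts (b ∷ β) in eq
       | intervalSum-leafCounts 0 (b ∷ β) positive (s≤s z≤n)
       | intervalSum-leafCounts (e + suc a) (b ∷ β) positive (s≤s z≤n)
  ... | []     | _  | _  = ⊥-elim (leafCounts≢[] b β eq)
  ... | d ∷ ds | ih₀ | ih₁ = begin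
    (w ⊛ q) ⊛ intervalSum (suc e + a ∷ d ∷ ds)
      ≈⟨ *-congˡ (intervalSum-+ (suc e) a (d ∷ ds)) ⟩
    (w ⊛ q) ⊛ (w ^ suc e ⊛ prefixSum a (d ∷ ds) ⊕ laterSum (d ∷ ds))
      ≈⟨ *-congˡ (+-cong (*-congˡ (prefixSum-∷ a d ds)) (laterSum-∷ d ds)) ⟩
    (w ⊛ q) ⊛ (w ^ suc e ⊛ (w ^ a ⊛ (y ⊕ z ⊛ Y)) ⊕ (y ⊛ Y ⊕ Z))
      ≈⟨ *-congˡ (+-congʳ (trans (sym (*-assoc _ _ _)) (*-congʳ E≈))) ⟩
    (w ⊛ q) ⊛ (E ⊛ (y ⊕ z ⊛ Y) ⊕ (y ⊛ Y ⊕ Z))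
      ≈⟨ solve 6 (λ y z q E Y Z → ((y :+ z) :* q) :* (E :* (y :+ z :* Y) :+ (y :* Y :+ Z))
                  := y :* (((y :+ z) :* E) :* q :+ q :* (((y :+ z) :* con 1) :* Y :+ Z))
                     :+ z :* (q :* (((y :+ z) :* E) :* Y :+ Z))) ≈-refl y z q E Y Z ⟩
    y ⊛ ((w ⊛ E) ⊛ q ⊕ q ⊛ (w ^ 1 ⊛ Y ⊕ Z)) ⊕ z ⊛ (q ⊛ ((w ⊛ E) ⊛ Y ⊕ Z))
      ≈⟨ +-cong (*-congˡ (+-congˡ (trans (*-congˡ (sym (intervalSum-+ 1 d ds))) ih₀)))
                (*-congˡ (trans (*-congˡ (sym (intervalSum-+ (suc (e + suc a)) d ds))) ih₁)) ⟩
    Hnum⁺ e (suc a ∷ b ∷ β) ∎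
    where
    q = w ^ length β
    Y = prefixSum d ds
    Z = laterSum ds
    E = w ^ (e + suc a)
    E≈ : w ^ suc e ⊛ w ^ a ≈ E
    E≈ = trans (sym (pow-+ w (suc e) a)) (reflexive (≡.cong (w ^_) (≡.sym (ℕ.+-suc e a))))

  coarseningWeight : ℕ → List ℕ → Carrier
  coarseningWeight n γ = y ^ (length γ ∸ 1) ⊛ z ^ (n ∸ length γ)

  partsSum : ℕ → List ℕ → Carrier
  partsSum e γ = Σ R (addToHead e γ) (λ g → w ^ suc g)

  partsSum-∷ : ∀ e a γ → partsSum e (a ∷ γ) ≡ w ^ suc (e + a) ⊕ partsSum 0 γ
  partsSum-∷ e a []      = refl
  partsSum-∷ e a (_ ∷ _) = refl

  partsSum-addToHead : ∀ e a γ → partsSum e (addToHead a γ) ≡ partsSum (e + a) γ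
  partsSum-addToHead e a []      = refl
  partsSum-addToHead e a (g ∷ γ) = ≡.cong (λ n → Σ R (n ∷ γ) (λ g → w ^ suc g)) (≡.sym (ℕ.+-assoc e a g))

  coarseningWeight-∷ : ∀ n a {γ} → TailAtMost n γ →
                       coarseningWeight (suc (suc n)) (a ∷ γ) ≈ y ⊛ coarseningWeight (suc n) γ
  coarseningWeight-∷ n a (nonEmpty _) = *-assoc _ _ _

  coarseningWeight-addToHead : ∀ n a {γ} → TailAtMost n γ →
                               coarseningWeight (suc (suc n)) (addToHead a γ) ≈ z ⊛ coarseningWeight (suc n) γ
  coarseningWeight-addToHead n a (nonEmpty le) rewrite ℕ.+-∸-assoc 1 le =
    solve 3 (λ p q r → p :* (r :* q) := r :* (p :* q)) ≈-refl _ _ z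

  Σ-coarsenings′-∷ : ∀ a b β (F : List ℕ → Carrier) → Σ R (coarsenings′ (a ∷ b ∷ β)) F ≈
    Σ R (coarsenings′ (b ∷ β)) (λ γ → F (a ∷ γ)) ⊕ Σ R (coarsenings′ (b ∷ β)) (λ γ → F (addToHead a γ))
  Σ-coarsenings′-∷ a b β F = trans (Σ-++ (map (a ∷_) C) _ F)
    (reflexive (≡.cong₂ _⊕_ (Σ-map (a ∷_) C F) (Σ-map (addToHead a) C F)))
    where C = coarsenings′ (b ∷ β)

  Σ-coarseningWeight : ∀ α → 1 ≤ length α →
                       Σ R (coarsenings′ α) (coarseningWeight (length α)) ≈ w ^ (length α ∸ 1)
  Σ-coarseningWeight (a ∷ [])    _ = trans (+-identityʳ _) (*-identityˡ _)
  Σ-coarseningWeight (a ∷ b ∷ β) _ = begin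
    Σ R (coarsenings′ (a ∷ b ∷ β)) (coarseningWeight (suc (suc (length β))))
      ≈⟨ Σ-coarsenings′-∷ a b β _ ⟩
    Σ R C (λ γ → coarseningWeight (suc (suc (length β))) (a ∷ γ)) ⊕
    Σ R C (λ γ → coarseningWeight (suc (suc (length β))) (addToHead a γ))
      ≈⟨ +-cong (trans (Σ-congᴬ (All.map (coarseningWeight-∷ _ a) (coarsenings′-tail b β))) (Σ-*ˡ C y _))
                (trans (Σ-congᴬ (All.map (coarseningWeight-addToHead _ a) (coarsenings′-tail b β))) (Σ-*ˡ C z _)) ⟩
    y ⊛ Σ R C (coarseningWeight (suc (length β))) ⊕ z ⊛ Σ R C (coarseningWeight (suc (length β)))
      ≈⟨ +-cong (*-congˡ (Σ-coarseningWeight (b ∷ β) (s≤s z≤n)))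
                (*-congˡ (Σ-coarseningWeight (b ∷ β) (s≤s z≤n))) ⟩
    y ⊛ w ^ length β ⊕ z ⊛ w ^ length β
      ≈⟨ sym (distribʳ _ y z) ⟩
    w ^ suc (length β) ∎
    where C = coarsenings′ (b ∷ β)

  Σ-coarsenings′ : ∀ e α → 1 ≤ length α →
    Σ R (coarsenings′ α) (λ γ → coarseningWeight (length α) γ ⊛ partsSum e γ) ≈ Hnum⁺ e α
  Σ-coarsenings′ e (a ∷ [])    _ = solve 1 (λ p → (con 1 :* con 1) :* (p :+ con 0) :+ con 0 := p) ≈-refl _
  Σ-coarsenings′ e (a ∷ b ∷ β) _ = begin
    Σ R (coarsenings′ (a ∷ b ∷ β)) F
      ≈⟨ Σ-coarsenings′-∷ a b β F ⟩
    Σ R C (λ γ → F (a ∷ γ)) ⊕ Σ R C (λ γ → F (addToHead a γ))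
      ≈⟨ +-cong (Σ-congᴬ (All.map kept (coarsenings′-tail b β)))
                (Σ-congᴬ (All.map merged (coarsenings′-tail b β))) ⟩
    Σ R C (λ γ → y ⊛ (M γ ⊛ W ⊕ M γ ⊛ partsSum 0 γ)) ⊕ Σ R C (λ γ → z ⊛ (M γ ⊛ partsSum (e + a) γ))
      ≈⟨ +-cong (trans (Σ-*ˡ C y _) (*-congˡ (trans (Σ-+ C _ _) (+-congʳ (Σ-*ʳ C W M))))) (Σ-*ˡ C z _) ⟩
    y ⊛ (Σ R C M ⊛ W ⊕ Σ R C (λ γ → M γ ⊛ partsSum 0 γ)) ⊕ z ⊛ Σ R C (λ γ → M γ ⊛ partsSum (e + a) γ)
      ≈⟨ +-cong (*-congˡ (+-cong (trans (*-congʳ (Σ-coarseningWeight (b ∷ β) (s≤s z≤n))) (*-comm _ _))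
                                 (Σ-coarsenings′ 0 (b ∷ β) (s≤s z≤n))))
                (*-congˡ (Σ-coarsenings′ (e + a) (b ∷ β) (s≤s z≤n))) ⟩
    Hnum⁺ e (a ∷ b ∷ β) ∎
    where
    C = coarsenings′ (b ∷ β)
    M = coarseningWeight (suc (length β))
    W = w ^ suc (e + a)
    F : List ℕ → Carrier
    F γ = coarseningWeight (suc (suc (length β))) γ ⊛ partsSum e γ
    kept : ∀ {γ} → TailAtMost (length β) γ → F (a ∷ γ) ≈ y ⊛ (M γ ⊛ W ⊕ M γ ⊛ partsSum 0 γ)
    kept {γ} t = trans (*-cong (coarseningWeight-∷ _ a t) (reflexive (partsSum-∷ e a γ)))
      (solve 4 (λ y m p q → (y :* m) :* (p :+ q) := y :* (m :* p :+ m :* q)) ≈-refl y (M γ) W _)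
    merged : ∀ {γ} → TailAtMost (length β) γ → F (addToHead a γ) ≈ z ⊛ (M γ ⊛ partsSum (e + a) γ)
    merged {γ} t = trans (*-cong (coarseningWeight-addToHead _ a t) (reflexive (partsSum-addToHead e a γ)))
      (*-assoc _ _ _)

  Hnum≈Hnum⁺ : ∀ α → All (1 ≤_) α → 1 ≤ length α → Hnum R α y z ≈ Hnum⁺ 0 α
  Hnum≈Hnum⁺ α positive 1≤ℓ = begin
    Σ R (coarsenings α) term
      ≈⟨ Σ-↭ term (coarsenings↭coarsenings′ α positive 1≤ℓ) ⟩
    Σ R (coarsenings′ α) term
      ≈⟨ Σ-cong (coarsenings′ α) (λ γ → reflexive (term≡ γ)) ⟩
    Σ R (coarsenings′ α) (λ γ → coarseningWeight (length α) γ ⊛ partsSum 0 γ)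
      ≈⟨ Σ-coarsenings′ 0 α 1≤ℓ ⟩
    Hnum⁺ 0 α ∎
    where
    term : List ℕ → Carrier
    term γ = y ^ (length γ ∸ 1) ⊛ z ^ (length α ∸ length γ) ⊛ Σ R γ (λ g → w ^ suc g)
    term≡ : ∀ γ → term γ ≡ coarseningWeight (length α) γ ⊛ partsSum 0 γ
    term≡ []      = refl
    term≡ (_ ∷ _) = refl

proposition6p2 : {a b : Level} (R : CommutativeSemiring a b) (α : List ℕ) →
    All (1 ≤_) α → 1 ≤ ℓ α → (y z : CommutativeSemiring.Carrier R) →
    CommutativeSemiring._≈_ R
      (CommutativeSemiring._*_ R (pow R (CommutativeSemiring._+_ R y z) (ℓ α ∸ 1))
        (Hbar R (Cat ((1 ∷ []) ⊙ (α ⊙ (1 ∷ [])))) y z))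
      (Hnum R α y z)
proposition6p2 R α positive 1≤ℓ y z = begin
  w ^ (length α ∸ 1) ⊛ Hbar R (Cat ((1 ∷ []) ⊙ (α ⊙ (1 ∷ [])))) y z
    ≡⟨ ≡.cong (λ c → w ^ (length α ∸ 1) ⊛ Hbar R (Cat c) y z) (1⊙α⊙1≡leafCounts α positive 1≤ℓ) ⟩
  w ^ (length α ∸ 1) ⊛ Hbar R (Cat (map suc D)) y z
    ≈⟨ *-congˡ (hbar≈intervalSum D (leafyEnds-leafCounts α positive 1≤ℓ)) ⟩
  w ^ (length α ∸ 1) ⊛ intervalSum D
    ≈⟨ intervalSum-leafCounts 0 α positive 1≤ℓ ⟩
  Hnum⁺ 0 α
    ≈⟨ sym (Hnum≈Hnum⁺ α positive 1≤ℓ) ⟩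
  Hnum R α y z ∎
  where
  open CommutativeSemiring R renaming (_*_ to _⊛_)
  open Polynomials R y z
  open import Relation.Binary.Reasoning.Setoid setoid
  D = addToHead 1 (leafCounts α)
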